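{- Let $p$ be an odd prime and let $\mathcal B(\mathcal G(p))=\{\beta_k:k\in\mathbb Z_p\}\cup\{\beta_{a,b}:a,b\in\mathbb Z_p\}$, where $\beta_k=\{(k,\kappa):\kappa\in\mathbb Z_p\}$ and $\beta_{a,b}=\{(k,ak+b):k\in\mathbb Z_p\}$. Define $\eta^{(\beta)}\in\mathbb C^p$ (coordinates indexed by $j\in\mathbb Z_p$) by $\eta^{(\beta_k)}_j=\delta_{k+(p-1)/2,\,j}$ and $\eta^{(\beta_{a,b})}_j=\frac1{\sqrt p}\zeta^{\frac{p+1}2 j(aj+2b+a)}$. Then $\{\eta^{(\beta)}\}_{\beta\in\mathcal B(\mathcal G(p))}$ is a maximal set of mutually unbiased bases of $\mathbb C^p$, in which each parallel class ($\{\beta_k\}_{k\in\mathbb Z_p}$, and $\{\beta_{a,b}\}_{b\in\mathbb Z_p}$ for each fixed $a$) corresponds to the vectors of one orthonormal basis. Furthermore, for each $\beta$, $$\mathrm{span}\,\eta^{(\beta)}=\Big(\mathrm{span}\{M^\kappa T^k\phi_i:(k,\kappa)\in\beta,\ i\in\{0,\dots,(p-3)/2\}\}\Big)^\perp.$$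
   Context: Fix a primitive $p$-th root of unity $\zeta$ (the one used to build $\mathcal G(p)$). On $\mathbb C^p$ with standard basis $\{e_j\}_{j\in\mathbb Z_p}$, $Te_j=e_{j+1}$ and $Me_j=\zeta^je_j$. For $i\in\{0,\dots,(p-3)/2\}$, $\phi_i=e_i-e_{p-1-i}$; $\psi$ is the concatenation $\phi_0\oplus\cdots\oplus\phi_{(p-3)/2}$, $\pi(k,\kappa)=I_{(p-1)/2}\otimes(M^\kappa T^k)$, and $\mathcal G(p)=\{\pi(k,\kappa)\psi\}_{(k,\kappa)\in\mathbb Z_p^2}$; its binder (set of simplices) is the set of sets $\beta_k,\beta_{a,b}$ listed in the claim. In exponents, $\frac{p+1}{2}$ is the inverse of $2$ modulo $p$. A maximal set of mutually unbiased bases of $\mathbb C^p$ consists of $p+1$ orthonormal bases such that any two vectors $\eta,\eta'$ from different bases satisfy $|\langle\eta,\eta'\rangle|=1/\sqrt p$. -}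

module Defs where

open import Level using (_⊔_) renaming (suc to lsuc)
open import Algebra.Bundles using (CommutativeRing)
open import Data.Nat as ℕ using (ℕ; zero; suc; NonZero; _%_; _/_)
open import Data.Fin as Fin using (Fin; toℕ; fromℕ<)
open import Data.Nat.DivMod using (m%n<n)
open import Data.Product using (Σ; ∃; _×_; _,_; proj₁; proj₂)
open import Data.List using (List; []; _∷_)
open import Relation.Binary.PropositionalEquality using (_≡_)
open import Relation.Nullary using (¬_)

-- A field with an involutive automorphism ("complex conjugation").
-- ℂ with z ↦ z̄ is an instance; the theorem is stated for every such
-- field.

record StarField c ℓ : Set (lsuc (c ⊔ ℓ)) where
  field
    commRing : CommutativeRing c ℓ
  open CommutativeRing commRing public
  field
    1≉0      : ¬ (1# ≈ 0#)
    inverse  : ∀ x → ¬ (x ≈ 0#) → ∃ λ y → x * y ≈ 1#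
    conj     : Carrier → Carrier
    conj-cong : ∀ {x y} → x ≈ y → conj x ≈ conj y
    conj-+   : ∀ x y → conj (x + y) ≈ conj x + conj y
    conj-*   : ∀ x y → conj (x * y) ≈ conj x * conj y
    conj-1   : conj 1# ≈ 1#
    conj-inv : ∀ x → conj (conj x) ≈ x

module Construction {c ℓ} (F : StarField c ℓ) where
  open StarField F

  infixr 8 _^_
  _^_ : Carrier → ℕ → Carrier
  x ^ zero  = 1#
  x ^ suc n = x * (x ^ n)

  fromℕ : ℕ → Carrier
  fromℕ zero    = 0#
  fromℕ (suc n) = 1# + fromℕ n

  Vec : ℕ → Set c
  Vec p = Fin p → Carrier

  _≈ᵥ_ : ∀ {p} → Vec p → Vec p → Set ℓ
  u ≈ᵥ v = ∀ j → u j ≈ v j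

  sumF : ∀ {n} → (Fin n → Carrier) → Carrier
  sumF {zero}  f = 0#
  sumF {suc n} f = f Fin.zero + sumF (λ j → f (Fin.suc j))

  ⟨_,_⟩ : ∀ {p} → Vec p → Vec p → Carrier
  ⟨ u , v ⟩ = sumF (λ j → conj (u j) * v j)

  lincomb : ∀ {p} {I : Set} → (I → Vec p) → List (Carrier × I) → Vec p
  lincomb g []            j = 0#
  lincomb g ((a , i) ∷ l) j = a * g i j + lincomb g l j

  InSpan : ∀ {p} {I : Set} → (I → Vec p) → Vec p → Set (c ⊔ ℓ)
  InSpan g v = ∃ λ l → v ≈ᵥ lincomb g l

  InPerpSpan : ∀ {p} {I : Set} → (I → Vec p) → Vec p → Set (c ⊔ ℓ)
  InPerpSpan g v = ∀ w → InSpan g w → ⟨ w , v ⟩ ≈ 0#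

  module ZMod (p : ℕ) .{{_ : NonZero p}} where
    [_] : ℕ → Fin p
    [ n ] = fromℕ< (m%n<n n p)

    -- T e_j = e_{j+1},  M e_j = ζ^j e_j   (as operators on coordinates)
    T : Vec p → Vec p
    T v j = v [ toℕ j ℕ.+ (p ℕ.∸ 1) ]

    Mop : Carrier → Vec p → Vec p
    Mop ζ v j = (ζ ^ toℕ j) * v j

    iter : ℕ → (Vec p → Vec p) → Vec p → Vec p
    iter zero    f v = v
    iter (suc n) f v = f (iter n f v)

    e : Fin p → Vec p
    e j j' with toℕ j ℕ.≟ toℕ j'
    ... | Relation.Nullary.yes _ = 1#
    ... | Relation.Nullary.no  _ = 0#

    φ : Fin ((p ℕ.∸ 1) / 2) → Vec p
    φ i j = e [ toℕ i ] j - e [ p ℕ.∸ 1 ℕ.∸ toℕ i ] j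

    data Block : Set where
      βv : Fin p → Block
      βl : Fin p → Fin p → Block

    _∈β_ : Fin p × Fin p → Block → Set
    (k , κ) ∈β βv k'   = k ≡ k'
    (k , κ) ∈β βl a b  = κ ≡ [ toℕ a ℕ.* toℕ k ℕ.+ toℕ b ]

    data Class : Set where
      vert : Class
      slope : Fin p → Class

    classOf : Block → Class
    classOf (βv _)   = vert
    classOf (βl a _) = slope a

    GenIx : Block → Set
    GenIx β = Σ (Fin p × Fin p) (λ kκ → kκ ∈β β) × Fin ((p ℕ.∸ 1) / 2)

    gen : Carrier → (β : Block) → GenIx β → Vec p
    gen ζ β (((k , κ) , _) , i) = iter (toℕ κ) (Mop ζ) (iter (toℕ k) T (φ i))

    -- the vectors η^{(β)}; s plays the role of 1/√p
    η : Carrier → Carrier → Block → Vec p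
    η ζ s (βv k)   j = e [ toℕ k ℕ.+ (p ℕ.∸ 1) / 2 ] j
    η ζ s (βl a b) j =
      s * ζ ^ ((p ℕ.+ 1) / 2 ℕ.* toℕ j ℕ.* (toℕ a ℕ.* toℕ j ℕ.+ 2 ℕ.* toℕ b ℕ.+ toℕ a))

    InSpan1 : Vec p → Vec p → Set (c ⊔ ℓ)
    InSpan1 u v = ∃ λ (λ' : Carrier) → v ≈ᵥ (λ j → λ' * u j)

-- η^{(β_k)} is the standard basis vector at k + h, h = (p − 1)/2, and η^{(β_{a,b})} is
-- j ↦ s·ζ^{φ(j)} with the quadratic phase φ(j) = ((p + 1)/2)·j(aj + 2b + a), where s² = 1/p.
-- Phases of equal slope differ by a linear form cj with p ∤ c, and Σ_j ζ^{cj} = 0 because ζ has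
-- order p; this gives orthogonality within a class and, summing over b instead, the completeness
-- relation Σ_b conj η_b(i) η_b(j) = δ_ij, so each class spans. Phases of different slopes differ
-- by a quadratic with p ∤ 2α, and the Gauss sum G of such a quadratic has |G|² = p.
-- The generator M^κ T^k φ_i lives on the two points k + i and k − 1 − i, symmetric about k + h.
-- It is orthogonal to η^{(β_k)}, which vanishes there, and to η^{(β_{a,b})}, because for
-- κ = ak + b the twisted phase φ(j) − κj is symmetric about k + h. Conversely, for β_k the
-- generators with κ = 0 and κ = 1 force v to vanish off k + h, and for β_{a,b} the generators
-- with i = 0 give the recursion v(n + 1) = ζ^{a(n+1)+b} v(n), solved by a multiple of η^{(β_{a,b})}.

module Submission where

open import Defs
open import Level using (Level)
open import Data.Nat using (ℕ; NonZero; _%_)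
open import Data.Nat.Primality using (Prime)
open import Data.Product using (Σ; _×_; _,_; proj₁)
open import Relation.Binary.PropositionalEquality using (_≡_; _≢_)
open import Relation.Nullary using (¬_)

open import Data.Nat as ℕ using (zero; suc)
import Data.Nat.Properties as ℕ
open import Data.Fin as Fin using (Fin; toℕ)
import Data.Fin.Properties as Fin
open import Data.List using ([]; _∷_; tabulate)
import Relation.Binary.PropositionalEquality as ≡
import Relation.Binary.Reasoning.Setoid as SetoidReasoning

module StarFieldProperties {c ℓ} (F : StarField c ℓ) where
  open StarField F
  open Construction F
  open SetoidReasoning setoid
  open import Algebra.Definitions _≈_ using (AlmostLeftCancellative)
  open import Algebra.Properties.Ring ring using (x+x≈x⇒x≈0; [y-z]x≈yx-zx)
  open import Algebra.Properties.AbelianGroup +-abelianGroup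
    using (ε⁻¹≈ε; inverseʳ-unique; ⁻¹-∙-comm; ∙-cancelʳ; x∙y⁻¹≈ε⇒x≈y)
  open import Algebra.Solver.Ring.NaturalCoefficients.Default commutativeSemiring
    using (solve; _:=_; _:+_; _:*_; con)

  conj-0# : conj 0# ≈ 0#
  conj-0# = x+x≈x⇒x≈0 _ (trans (sym (conj-+ 0# 0#)) (conj-cong (+-identityʳ 0#)))

  conj-‿ : ∀ x → conj (- x) ≈ - conj x
  conj-‿ x = inverseʳ-unique (conj x) (conj (- x))
    (trans (sym (conj-+ x (- x))) (trans (conj-cong (-‿inverseʳ x)) conj-0#))

  conj-sub : ∀ x y → conj (x - y) ≈ conj x - conj y
  conj-sub x y = trans (conj-+ x (- y)) (+-congˡ (conj-‿ y))

  *-cancelˡ-nonZero : AlmostLeftCancellative 0# _*_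
  *-cancelˡ-nonZero x y z x≉0 xy≈xz with inverse x x≉0
  ... | x⁻¹ , xx⁻¹≈1 = begin
    y                ≈⟨ undo y ⟨
    x⁻¹ * (x * y)    ≈⟨ *-congˡ xy≈xz ⟩
    x⁻¹ * (x * z)    ≈⟨ undo z ⟩
    z                ∎
    where
    undo : ∀ w → x⁻¹ * (x * w) ≈ w
    undo w = begin
      x⁻¹ * (x * w)  ≈⟨ solve 3 (λ x x⁻¹ w → x⁻¹ :* (x :* w) := (x :* x⁻¹) :* w) refl x x⁻¹ w ⟩
      (x * x⁻¹) * w  ≈⟨ *-congʳ xx⁻¹≈1 ⟩
      1# * w         ≈⟨ *-identityˡ w ⟩
      w              ∎

  x*y≈0⇒y≈0 : ∀ {x y} → ¬ x ≈ 0# → x * y ≈ 0# → y ≈ 0#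
  x*y≈0⇒y≈0 {x} {y} x≉0 xy≈0 = *-cancelˡ-nonZero x y 0# x≉0 (trans xy≈0 (sym (zeroʳ x)))

  ^-cong : ∀ {x y} n → x ≈ y → x ^ n ≈ y ^ n
  ^-cong zero    x≈y = refl
  ^-cong (suc n) x≈y = *-cong x≈y (^-cong n x≈y)

  ^-+ : ∀ x m n → x ^ (m ℕ.+ n) ≈ x ^ m * x ^ n
  ^-+ x zero    n = sym (*-identityˡ _)
  ^-+ x (suc m) n = trans (*-congˡ (^-+ x m n)) (sym (*-assoc _ _ _))

  ^-* : ∀ x m n → x ^ (m ℕ.* n) ≈ (x ^ n) ^ m
  ^-* x zero    n = refl
  ^-* x (suc m) n = trans (^-+ x n (m ℕ.* n)) (*-congˡ (^-* x m n))

  1^n≈1 : ∀ n → 1# ^ n ≈ 1#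
  1^n≈1 zero    = refl
  1^n≈1 (suc n) = trans (*-identityˡ _) (1^n≈1 n)

  ^-multiple≈1 : ∀ {w} n → w ^ n ≈ 1# → ∀ m → w ^ (m ℕ.* n) ≈ 1#
  ^-multiple≈1 {w} n wⁿ≈1 m = trans (^-* w m n) (trans (^-cong m wⁿ≈1) (1^n≈1 m))

  conj-^ : ∀ x n → conj (x ^ n) ≈ conj x ^ n
  conj-^ x zero    = conj-1
  conj-^ x (suc n) = trans (conj-* _ _) (*-congˡ (conj-^ x n))

  sumF-cong : ∀ {n} {f g : Fin n → Carrier} → (∀ j → f j ≈ g j) → sumF f ≈ sumF g
  sumF-cong {zero}  f≈g = refl
  sumF-cong {suc n} f≈g = +-cong (f≈g Fin.zero) (sumF-cong (λ j → f≈g (Fin.suc j)))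

  sumF-zero : ∀ {n} {f : Fin n → Carrier} → (∀ j → f j ≈ 0#) → sumF f ≈ 0#
  sumF-zero {zero}  f≈0 = refl
  sumF-zero {suc n} f≈0 =
    trans (+-cong (f≈0 Fin.zero) (sumF-zero (λ j → f≈0 (Fin.suc j)))) (+-identityʳ 0#)

  sumF-+ : ∀ {n} (f g : Fin n → Carrier) → sumF (λ j → f j + g j) ≈ sumF f + sumF g
  sumF-+ {zero}  f g = sym (+-identityʳ 0#)
  sumF-+ {suc n} f g = trans (+-congˡ (sumF-+ (λ j → f (Fin.suc j)) (λ j → g (Fin.suc j))))
    (solve 4 (λ a b c d → (a :+ b) :+ (c :+ d) := (a :+ c) :+ (b :+ d)) refl _ _ _ _)

  sumF-‿ : ∀ {n} (f : Fin n → Carrier) → sumF (λ j → - f j) ≈ - sumF f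
  sumF-‿ {zero}  f = sym ε⁻¹≈ε
  sumF-‿ {suc n} f = trans (+-congˡ (sumF-‿ (λ j → f (Fin.suc j)))) (⁻¹-∙-comm _ _)

  sumF-sub : ∀ {n} (f g : Fin n → Carrier) → sumF (λ j → f j - g j) ≈ sumF f - sumF g
  sumF-sub f g = trans (sumF-+ f (λ j → - g j)) (+-congˡ (sumF-‿ g))

  sumF-*ˡ : ∀ {n} x (f : Fin n → Carrier) → sumF (λ j → x * f j) ≈ x * sumF f
  sumF-*ˡ {zero}  x f = sym (zeroʳ x)
  sumF-*ˡ {suc n} x f = trans (+-congˡ (sumF-*ˡ x (λ j → f (Fin.suc j)))) (sym (distribˡ _ _ _))

  sumF-*ʳ : ∀ {n} x (f : Fin n → Carrier) → sumF (λ j → f j * x) ≈ sumF f * x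
  sumF-*ʳ x f = trans (sumF-cong (λ j → *-comm (f j) x)) (trans (sumF-*ˡ x f) (*-comm _ _))

  sumF-const : ∀ n x → sumF {n} (λ _ → x) ≈ fromℕ n * x
  sumF-const zero    x = sym (zeroˡ x)
  sumF-const (suc n) x = trans (+-cong (sym (*-identityˡ x)) (sumF-const n x)) (sym (distribʳ _ _ _))

  conj-sumF : ∀ {n} (f : Fin n → Carrier) → conj (sumF f) ≈ sumF (λ j → conj (f j))
  conj-sumF {zero}  f = conj-0#
  conj-sumF {suc n} f = trans (conj-+ _ _) (+-congˡ (conj-sumF (λ j → f (Fin.suc j))))

  sumF-swap : ∀ {m n} (f : Fin m → Fin n → Carrier) →
    sumF (λ i → sumF (λ j → f i j)) ≈ sumF (λ j → sumF (λ i → f i j))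
  sumF-swap {zero} {n} f = sym (sumF-zero {n} (λ _ → refl))
  sumF-swap {suc m} f = trans (+-congˡ (sumF-swap (λ i → f (Fin.suc i))))
    (sym (sumF-+ (f Fin.zero) (λ j → sumF (λ i → f (Fin.suc i) j))))

  sumF-delta : ∀ {n} (m : Fin n) (f : Fin n → Carrier) → (∀ j → j ≢ m → f j ≈ 0#) → sumF f ≈ f m
  sumF-delta Fin.zero    f f≈0 =
    trans (+-congˡ (sumF-zero (λ j → f≈0 (Fin.suc j) λ ()))) (+-identityʳ _)
  sumF-delta (Fin.suc m) f f≈0 = trans
    (+-cong (f≈0 Fin.zero λ ()) (sumF-delta m (λ j → f (Fin.suc j)) (λ j j≢m → f≈0 (Fin.suc j) (λ eq → j≢m (Fin.suc-injective eq)))))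
    (+-identityˡ _)

  powerSum : Carrier → ℕ → Carrier
  powerSum w n = sumF {n} (λ j → w ^ toℕ j)

  powerSum-telescope : ∀ w n → w * powerSum w n + 1# ≈ powerSum w n + w ^ n
  powerSum-telescope w zero = +-congʳ (zeroʳ w)
  powerSum-telescope w (suc n) = begin
    w * (1# + S′) + 1#       ≈⟨ +-congʳ (*-congˡ (+-congˡ (sumF-*ˡ {n} w (λ j → w ^ toℕ j)))) ⟩
    w * (1# + w * S) + 1#    ≈⟨ solve 2 (λ w S → w :* (con 1 :+ w :* S) :+ con 1 := w :* (w :* S :+ con 1) :+ con 1) refl w S ⟩
    w * (w * S + 1#) + 1#    ≈⟨ +-congʳ (*-congˡ (powerSum-telescope w n)) ⟩
    w * (S + w ^ n) + 1#     ≈⟨ solve 3 (λ w S wⁿ → w :* (S :+ wⁿ) :+ con 1 := (con 1 :+ w :* S) :+ w :* wⁿ) refl w S (w ^ n) ⟩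
    (1# + w * S) + w * w ^ n ≈⟨ +-congʳ (+-congˡ (sumF-*ˡ {n} w (λ j → w ^ toℕ j))) ⟨
    (1# + S′) + w * w ^ n    ∎
    where
    S  = powerSum w n
    S′ = sumF {n} (λ j → w * w ^ toℕ j)

  powerSum-root : ∀ {w n} → w ^ n ≈ 1# → ¬ w ≈ 1# → powerSum w n ≈ 0#
  powerSum-root {w} {n} wⁿ≈1 w≉1 = x*y≈0⇒y≈0 (λ w-1≈0 → w≉1 (x∙y⁻¹≈ε⇒x≈y w 1# w-1≈0)) (begin
    (w - 1#) * S        ≈⟨ [y-z]x≈yx-zx S w 1# ⟩
    w * S - 1# * S      ≈⟨ +-cong wS≈S (-‿cong (*-identityˡ S)) ⟩
    S - S               ≈⟨ -‿inverseʳ S ⟩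
    0#                  ∎)
    where
    S = powerSum w n
    wS≈S : w * S ≈ S
    wS≈S = ∙-cancelʳ 1# (w * S) S (trans (powerSum-telescope w n) (+-congˡ wⁿ≈1))

  sumℕ : ℕ → (ℕ → Carrier) → Carrier
  sumℕ zero    f = 0#
  sumℕ (suc n) f = f 0 + sumℕ n (λ j → f (suc j))

  sumF≈sumℕ : ∀ {n} (f : Fin n → Carrier) (g : ℕ → Carrier) → (∀ j → f j ≈ g (toℕ j)) → sumF f ≈ sumℕ n g
  sumF≈sumℕ {zero}  f g f≈g = refl
  sumF≈sumℕ {suc n} f g f≈g =
    +-cong (f≈g Fin.zero) (sumF≈sumℕ (λ j → f (Fin.suc j)) (λ j → g (suc j)) (λ j → f≈g (Fin.suc j)))

  sumℕ-cong : ∀ n {f g : ℕ → Carrier} → (∀ j → f j ≈ g j) → sumℕ n f ≈ sumℕ n g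
  sumℕ-cong zero    f≈g = refl
  sumℕ-cong (suc n) f≈g = +-cong (f≈g 0) (sumℕ-cong n (λ j → f≈g (suc j)))

  sumℕ-snoc : ∀ n (f : ℕ → Carrier) → sumℕ (suc n) f ≈ sumℕ n f + f n
  sumℕ-snoc zero    f = trans (+-identityʳ _) (sym (+-identityˡ _))
  sumℕ-snoc (suc n) f = trans (+-congˡ (sumℕ-snoc n (λ j → f (suc j)))) (sym (+-assoc _ _ _))

  sumℕ-rotate : ∀ n (f : ℕ → Carrier) → f n ≈ f 0 → sumℕ n (λ j → f (suc j)) ≈ sumℕ n f
  sumℕ-rotate zero    f fn≈f0 = refl
  sumℕ-rotate (suc n) f fn≈f0 = begin
    sumℕ (suc n) (λ j → f (suc j))     ≈⟨ sumℕ-snoc n (λ j → f (suc j)) ⟩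
    sumℕ n (λ j → f (suc j)) + f (suc n) ≈⟨ +-comm _ _ ⟩
    f (suc n) + sumℕ n (λ j → f (suc j)) ≈⟨ +-congʳ fn≈f0 ⟩
    f 0 + sumℕ n (λ j → f (suc j))     ∎

  sumℕ-shift : ∀ n (f : ℕ → Carrier) → (∀ j → f (j ℕ.+ n) ≈ f j) → ∀ k →
    sumℕ n (λ j → f (j ℕ.+ k)) ≈ sumℕ n f
  sumℕ-shift n f f-periodic zero = sumℕ-cong n (λ j → reflexive (≡.cong f (ℕ.+-identityʳ j)))
  sumℕ-shift n f f-periodic (suc k) = begin
    sumℕ n (λ j → f (j ℕ.+ suc k))  ≈⟨ sumℕ-cong n (λ j → reflexive (≡.cong f (ℕ.+-suc j k))) ⟩
    sumℕ n (λ j → f (suc j ℕ.+ k))  ≈⟨ sumℕ-rotate n (λ j → f (j ℕ.+ k))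
                                         (trans (reflexive (≡.cong f (ℕ.+-comm n k))) (f-periodic k)) ⟩
    sumℕ n (λ j → f (j ℕ.+ k))      ≈⟨ sumℕ-shift n f f-periodic k ⟩
    sumℕ n f                        ∎

module InnerProductProperties {c ℓ} (F : StarField c ℓ) {n : ℕ} where
  open StarField F
  open Construction F
  open StarFieldProperties F
  open SetoidReasoning setoid
  open import Algebra.Solver.Ring.NaturalCoefficients.Default commutativeSemiring
    using (solve; _:=_; _:+_; _:*_)

  ⟨⟩-congˡ : ∀ {u u′ : Vec n} (v : Vec n) → u ≈ᵥ u′ → ⟨ u , v ⟩ ≈ ⟨ u′ , v ⟩
  ⟨⟩-congˡ v u≈u′ = sumF-cong {n} (λ j → *-congʳ (conj-cong (u≈u′ j)))

  ⟨⟩-congʳ : ∀ (u : Vec n) {v v′ : Vec n} → v ≈ᵥ v′ → ⟨ u , v ⟩ ≈ ⟨ u , v′ ⟩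
  ⟨⟩-congʳ u v≈v′ = sumF-cong {n} (λ j → *-congˡ (v≈v′ j))

  ⟨⟩-*ʳ : ∀ (u w : Vec n) x → ⟨ u , (λ j → x * w j) ⟩ ≈ x * ⟨ u , w ⟩
  ⟨⟩-*ʳ u w x = trans
    (sumF-cong {n} (λ j → solve 3 (λ u x w → u :* (x :* w) := x :* (u :* w)) refl (conj (u j)) x (w j)))
    (sumF-*ˡ {n} x (λ j → conj (u j) * w j))

  ⟨lincomb⟩≈0 : ∀ {I : Set} (g : I → Vec n) (v : Vec n) → (∀ i → ⟨ g i , v ⟩ ≈ 0#) →
    ∀ l → ⟨ lincomb g l , v ⟩ ≈ 0#
  ⟨lincomb⟩≈0 g v g⊥v [] = sumF-zero {n} (λ j → trans (*-congʳ conj-0#) (zeroˡ _))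
  ⟨lincomb⟩≈0 g v g⊥v ((a , i) ∷ l) = begin
    sumF (λ j → conj (a * g i j + lincomb g l j) * v j)
      ≈⟨ sumF-cong {n} (λ j → *-congʳ (trans (conj-+ _ _) (+-congʳ (conj-* _ _)))) ⟩
    sumF (λ j → (conj a * conj (g i j) + conj (lincomb g l j)) * v j)
      ≈⟨ sumF-cong {n} (λ j → solve 4 (λ a x y w → (a :* x :+ y) :* w := a :* (x :* w) :+ y :* w)
                                  refl (conj a) (conj (g i j)) (conj (lincomb g l j)) (v j)) ⟩
    sumF (λ j → conj a * (conj (g i j) * v j) + conj (lincomb g l j) * v j)
      ≈⟨ sumF-+ {n} _ _ ⟩
    sumF (λ j → conj a * (conj (g i j) * v j)) + ⟨ lincomb g l , v ⟩
      ≈⟨ +-cong (sumF-*ˡ {n} (conj a) (λ j → conj (g i j) * v j)) (⟨lincomb⟩≈0 g v g⊥v l) ⟩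
    conj a * ⟨ g i , v ⟩ + 0#
      ≈⟨ trans (+-identityʳ _) (trans (*-congˡ (g⊥v i)) (zeroʳ _)) ⟩
    0# ∎

  ⊥-generators⇒InPerpSpan : ∀ {I : Set} (g : I → Vec n) (v : Vec n) →
    (∀ i → ⟨ g i , v ⟩ ≈ 0#) → InPerpSpan g v
  ⊥-generators⇒InPerpSpan g v g⊥v w (l , w≈l) = trans (⟨⟩-congˡ v w≈l) (⟨lincomb⟩≈0 g v g⊥v l)

  InPerpSpan⇒⊥-generator : ∀ {I : Set} (g : I → Vec n) (v : Vec n) → InPerpSpan g v →
    ∀ i → ⟨ g i , v ⟩ ≈ 0#
  InPerpSpan⇒⊥-generator g v v⊥ i =
    v⊥ (g i) (((1# , i) ∷ []) , λ j → sym (trans (+-identityʳ _) (*-identityˡ _)))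

  ⟨⟩-swap : ∀ (u v : Vec n) → ⟨ v , u ⟩ ≈ conj ⟨ u , v ⟩
  ⟨⟩-swap u v = sym (trans (conj-sumF {n} _) (sumF-cong {n} (λ j →
    trans (conj-* _ _) (trans (*-congʳ (conj-inv (u j))) (*-comm _ _)))))

  lincomb-tabulate : ∀ {m} {I : Set} (g : I → Vec n) (x : Fin m → Carrier) (y : Fin m → I) →
    lincomb g (tabulate (λ k → x k , y k)) ≈ᵥ (λ j → sumF (λ k → x k * g (y k) j))
  lincomb-tabulate {zero}  g x y j = refl
  lincomb-tabulate {suc m} g x y j =
    +-congˡ (lincomb-tabulate g (λ k → x (Fin.suc k)) (λ k → y (Fin.suc k)) j)

  expansion : ∀ {m} (u : Fin m → Vec n) (v : Vec n) j →
    sumF (λ b → ⟨ u b , v ⟩ * u b j) ≈ sumF (λ i → v i * sumF (λ b → conj (u b i) * u b j))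
  expansion {m} u v j = begin
    sumF (λ b → ⟨ u b , v ⟩ * u b j)
      ≈⟨ sumF-cong {m} (λ b → trans (sym (sumF-*ʳ {n} (u b j) _)) (sumF-cong {n} (λ i →
           solve 3 (λ x y z → (x :* y) :* z := y :* (x :* z)) refl (conj (u b i)) (v i) (u b j)))) ⟩
    sumF (λ b → sumF (λ i → v i * (conj (u b i) * u b j)))
      ≈⟨ sumF-swap {m} {n} _ ⟩
    sumF (λ i → sumF (λ b → v i * (conj (u b i) * u b j)))
      ≈⟨ sumF-cong {n} (λ i → sumF-*ˡ {m} (v i) _) ⟩
    sumF (λ i → v i * sumF (λ b → conj (u b i) * u b j)) ∎

module ResidueIndices {c ℓ} (F : StarField c ℓ) (p : ℕ) {{_ : NonZero p}} where
  open StarField F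
  open Construction F
  open ZMod p
  open StarFieldProperties F
  open SetoidReasoning setoid
  open import Data.Nat.DivMod
    using (m%n<n; m<n⇒m%n≡m; %-distribˡ-+; m%n%n≡m%n; [m+kn]%n≡m%n; [m+n]%n≡m%n; m≡m%n+[m/n]*n)
  open import Relation.Nullary using (yes; no)
  open import Data.Empty using (⊥-elim)

  infix 4 _≋_
  _≋_ : ℕ → ℕ → Set
  x ≋ y = x % p ≡ y % p

  ≋-+ : ∀ {a b c d} → a ≋ b → c ≋ d → a ℕ.+ c ≋ b ℕ.+ d
  ≋-+ {a} {b} {c} {d} a≋b c≋d = ≡.trans (%-distribˡ-+ a c p)
    (≡.trans (≡.cong₂ (λ x y → (x ℕ.+ y) % p) a≋b c≋d) (≡.sym (%-distribˡ-+ b d p)))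

  k+k[p-1]≡kp : ∀ k → k ℕ.+ k ℕ.* (p ℕ.∸ 1) ≡ k ℕ.* p
  k+k[p-1]≡kp k = ≡.trans (≡.sym (ℕ.*-suc k (p ℕ.∸ 1))) (≡.cong (k ℕ.*_) (ℕ.suc-pred p))

  ≋-+-cancelʳ : ∀ a b c → a ℕ.+ c ≋ b ℕ.+ c → a ≋ b
  ≋-+-cancelʳ a b c a+c≋b+c = ≡.trans (≡.sym (undo a)) (≡.trans (≋-+ a+c≋b+c ≡.refl) (undo b))
    where
    undo : ∀ x → x ℕ.+ c ℕ.+ c ℕ.* (p ℕ.∸ 1) ≋ x
    undo x = ≡.trans (≡.cong (_% p) (≡.trans (ℕ.+-assoc x c _) (≡.cong (x ℕ.+_) (k+k[p-1]≡kp c))))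
                     ([m+kn]%n≡m%n x c p)

  ≋⇒≡ : ∀ {x y} → x ℕ.< p → y ℕ.< p → x ≋ y → x ≡ y
  ≋⇒≡ x<p y<p x≋y = ≡.trans (≡.sym (m<n⇒m%n≡m x<p)) (≡.trans x≋y (m<n⇒m%n≡m y<p))

  toℕ-[] : ∀ n → toℕ [ n ] ≡ n % p
  toℕ-[] n = Fin.toℕ-fromℕ< (m%n<n n p)

  toℕ-[]-≋ : ∀ n → toℕ [ n ] ≋ n
  toℕ-[]-≋ n = ≡.trans (≡.cong (_% p) (toℕ-[] n)) (m%n%n≡m%n n p)

  []-cong : ∀ {m n} → m ≋ n → [ m ] ≡ [ n ]
  []-cong m≋n = Fin.toℕ-injective (≡.trans (toℕ-[] _) (≡.trans m≋n (≡.sym (toℕ-[] _))))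

  []-toℕ : ∀ j → [ toℕ j ] ≡ j
  []-toℕ j = Fin.toℕ-injective (≡.trans (toℕ-[] (toℕ j)) (m<n⇒m%n≡m (Fin.toℕ<n j)))

  toℕ-[]-< : ∀ {n} → n ℕ.< p → toℕ [ n ] ≡ n
  toℕ-[]-< n<p = ≡.trans (toℕ-[] _) (m<n⇒m%n≡m n<p)

  []-+p : ∀ n → [ n ℕ.+ p ] ≡ [ n ]
  []-+p n = []-cong ([m+n]%n≡m%n n p)

  toℕ-[]-≡⇒≋ : ∀ {m n} → toℕ [ m ] ≡ toℕ [ n ] → m ≋ n
  toℕ-[]-≡⇒≋ {m} {n} eq = ≡.trans (≡.sym (toℕ-[]-≋ m)) (≡.trans (≡.cong (_% p) eq) (toℕ-[]-≋ n))

  []-injective : ∀ {x y} k → x ℕ.< p → y ℕ.< p → [ x ℕ.+ k ] ≡ [ y ℕ.+ k ] → x ≡ y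
  []-injective {x} {y} k x<p y<p eq =
    ≋⇒≡ x<p y<p (≋-+-cancelʳ x y k (toℕ-[]-≡⇒≋ (≡.cong toℕ eq)))

  pos : Fin p → ℕ → Fin p
  pos k d = [ d ℕ.+ toℕ k ]

  pos-injective : ∀ k {x y} → x ℕ.< p → y ℕ.< p → pos k x ≡ pos k y → x ≡ y
  pos-injective k = []-injective (toℕ k)

  offset : Fin p → Fin p → ℕ
  offset k j = (toℕ j ℕ.+ (p ℕ.∸ toℕ k)) % p

  offset<p : ∀ k j → offset k j ℕ.< p
  offset<p k j = m%n<n _ p

  pos-offset : ∀ k j → pos k (offset k j) ≡ j
  pos-offset k j = ≡.trans ([]-cong offset+k≋j) ([]-toℕ j)
    where
    offset+k≋j : offset k j ℕ.+ toℕ k ≋ toℕ j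
    offset+k≋j = ≡.trans (≋-+ (m%n%n≡m%n _ p) ≡.refl) (≡.trans (≡.cong (_% p)
      (≡.trans (ℕ.+-assoc (toℕ j) _ (toℕ k)) (≡.cong (toℕ j ℕ.+_) (ℕ.m∸n+n≡m (ℕ.<⇒≤ (Fin.toℕ<n k))))))
      ([m+n]%n≡m%n (toℕ j) p))

  mirror : ℕ → ℕ
  mirror d = p ℕ.∸ 1 ℕ.∸ d

  periodic-% : (g : ℕ → Carrier) → (∀ n → g (n ℕ.+ p) ≈ g n) → ∀ n → g (n % p) ≈ g n
  periodic-% g g-periodic n =
    sym (trans (reflexive (≡.cong g (m≡m%n+[m/n]*n n p))) (periodic-* (n % p) (n ℕ./ p)))
    where
    periodic-* : ∀ r q → g (r ℕ.+ q ℕ.* p) ≈ g r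
    periodic-* r zero    = reflexive (≡.cong g (ℕ.+-identityʳ r))
    periodic-* r (suc q) = trans
      (reflexive (≡.cong g (≡.trans (≡.cong (r ℕ.+_) (ℕ.+-comm p (q ℕ.* p))) (≡.sym (ℕ.+-assoc r (q ℕ.* p) p)))))
      (trans (g-periodic (r ℕ.+ q ℕ.* p)) (periodic-* r q))

  sumF-shift : ∀ (G : Fin p → Carrier) k → sumF {p} (λ t → G [ toℕ t ℕ.+ k ]) ≈ sumF G
  sumF-shift G k = begin
    sumF {p} (λ t → G [ toℕ t ℕ.+ k ]) ≈⟨ sumF≈sumℕ {p} _ (λ n → g (n ℕ.+ k)) (λ t → refl) ⟩
    sumℕ p (λ n → g (n ℕ.+ k))        ≈⟨ sumℕ-shift p g (λ n → reflexive (≡.cong G ([]-+p n))) k ⟩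
    sumℕ p g                          ≈⟨ sumF≈sumℕ {p} G g (λ j → reflexive (≡.cong G (≡.sym ([]-toℕ j)))) ⟨
    sumF G                            ∎
    where
    g : ℕ → Carrier
    g n = G [ n ]

  e-≡ : ∀ m j → toℕ m ≡ toℕ j → e m j ≡ 1#
  e-≡ m j eq with toℕ m ℕ.≟ toℕ j
  ... | yes _ = ≡.refl
  ... | no m≢j = ⊥-elim (m≢j eq)

  e-≢ : ∀ m j → toℕ m ≢ toℕ j → e m j ≡ 0#
  e-≢ m j m≢j with toℕ m ℕ.≟ toℕ j
  ... | yes eq = ⊥-elim (m≢j eq)
  ... | no _ = ≡.refl

  e-cong : ∀ m j m′ j′ → (toℕ m ≡ toℕ j → toℕ m′ ≡ toℕ j′) → (toℕ m′ ≡ toℕ j′ → toℕ m ≡ toℕ j) →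
    e m j ≡ e m′ j′
  e-cong m j m′ j′ to from with toℕ m ℕ.≟ toℕ j | toℕ m′ ℕ.≟ toℕ j′
  ... | yes _  | yes _  = ≡.refl
  ... | no _   | no _   = ≡.refl
  ... | yes eq | no ne  = ⊥-elim (ne (to eq))
  ... | no ne  | yes eq = ⊥-elim (ne (from eq))

  e-sym : ∀ m j → e m j ≡ e j m
  e-sym m j = e-cong m j j m ≡.sym ≡.sym

  conj-e : ∀ m j → conj (e m j) ≈ e m j
  conj-e m j with toℕ m ℕ.≟ toℕ j
  ... | yes _ = conj-1
  ... | no _  = conj-0#

  sumF-e : ∀ m (f : Fin p → Carrier) → sumF (λ j → e m j * f j) ≈ f m
  sumF-e m f = trans
    (sumF-delta m (λ j → e m j * f j)
      (λ j j≢m → trans (*-congʳ (reflexive (e-≢ m j (λ eq → j≢m (≡.sym (Fin.toℕ-injective eq)))))) (zeroˡ _)))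
    (trans (*-congʳ (reflexive (e-≡ m m ≡.refl))) (*-identityˡ _))

  ⟨e,⟩ : ∀ m (f : Fin p → Carrier) → ⟨ e m , f ⟩ ≈ f m
  ⟨e,⟩ m f = trans (sumF-cong {p} (λ j → *-congʳ (conj-e m j))) (sumF-e m f)

  h : ℕ
  h = (p ℕ.∸ 1) ℕ./ 2

  iter-T : ∀ n (v : Vec p) j → iter n T v j ≡ v [ toℕ j ℕ.+ n ℕ.* (p ℕ.∸ 1) ]
  iter-T zero    v j = ≡.cong v (≡.sym (≡.trans (≡.cong [_] (ℕ.+-identityʳ (toℕ j))) ([]-toℕ j)))
  iter-T (suc n) v j = ≡.trans (iter-T n v [ toℕ j ℕ.+ (p ℕ.∸ 1) ])
    (≡.cong v ([]-cong (≡.trans (≋-+ (toℕ-[]-≋ (toℕ j ℕ.+ (p ℕ.∸ 1))) ≡.refl)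
      (≡.cong (_% p) (ℕ.+-assoc (toℕ j) (p ℕ.∸ 1) (n ℕ.* (p ℕ.∸ 1)))))))

  iter-M : ∀ ζ n (v : Vec p) j → iter n (Mop ζ) v j ≈ (ζ ^ toℕ j) ^ n * v j
  iter-M ζ zero    v j = sym (*-identityˡ _)
  iter-M ζ (suc n) v j = trans (*-congˡ (iter-M ζ n v j)) (sym (*-assoc _ _ _))

  e-iter-T : ∀ x (k : Fin p) j → e [ x ] [ toℕ j ℕ.+ toℕ k ℕ.* (p ℕ.∸ 1) ] ≡ e (pos k x) j
  e-iter-T x k j = ≡.trans
    (e-cong [ x ] [ N ] (pos k x) [ toℕ j ]
      (λ eq → ≡.cong toℕ ([]-cong (≡.trans (≋-+ (toℕ-[]-≡⇒≋ eq) ≡.refl) N+k≋j)))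
      (λ eq → ≡.cong toℕ ([]-cong (≋-+-cancelʳ x N (toℕ k) (≡.trans (toℕ-[]-≡⇒≋ eq) (≡.sym N+k≋j))))))
    (≡.cong (e (pos k x)) ([]-toℕ j))
    where
    N = toℕ j ℕ.+ toℕ k ℕ.* (p ℕ.∸ 1)
    N+k≋j : N ℕ.+ toℕ k ≋ toℕ j
    N+k≋j = ≡.trans (≡.cong (_% p) (≡.trans (ℕ.+-assoc (toℕ j) _ (toℕ k))
              (≡.cong (toℕ j ℕ.+_) (≡.trans (ℕ.+-comm _ (toℕ k)) (k+k[p-1]≡kp (toℕ k))))))
            ([m+kn]%n≡m%n (toℕ j) (toℕ k) p)

  module _ (ζ : Carrier) (k κ : Fin p) (i : Fin h) where
    private
      P P′ : Fin p
      P  = pos k (toℕ i)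
      P′ = pos k (mirror (toℕ i))
      μ : Fin p → Carrier
      μ j = (ζ ^ toℕ j) ^ toℕ κ
    open import Algebra.Properties.Ring ring using ([y-z]x≈yx-zx)
    open import Algebra.Solver.Ring.NaturalCoefficients.Default commutativeSemiring
      using (solve; _:=_; _:*_)

    MT-φ : Vec p
    MT-φ = iter (toℕ κ) (Mop ζ) (iter (toℕ k) T (φ i))

    MT-φ-coordinate : ∀ j → MT-φ j ≈ μ j * (e P j - e P′ j)
    MT-φ-coordinate j = trans (iter-M ζ (toℕ κ) _ j) (*-congˡ (reflexive
      (≡.trans (iter-T (toℕ k) (φ i) j)
        (≡.cong₂ _-_ (e-iter-T (toℕ i) k j) (e-iter-T (mirror (toℕ i)) k j)))))

    ⟨MT-φ,⟩ : ∀ v → ⟨ MT-φ , v ⟩ ≈ conj (μ P) * v P - conj (μ P′) * v P′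
    ⟨MT-φ,⟩ v = begin
      sumF (λ j → conj (MT-φ j) * v j)           ≈⟨ sumF-cong {p} pointwise ⟩
      sumF (λ j → e P j * f j - e P′ j * f j)    ≈⟨ sumF-sub {p} (λ j → e P j * f j) (λ j → e P′ j * f j) ⟩
      sumF (λ j → e P j * f j) - sumF (λ j → e P′ j * f j) ≈⟨ +-cong (sumF-e P f) (-‿cong (sumF-e P′ f)) ⟩
      f P - f P′                                 ∎
      where
      f : Fin p → Carrier
      f j = conj (μ j) * v j
      pointwise : ∀ j → conj (MT-φ j) * v j ≈ e P j * f j - e P′ j * f j
      pointwise j = begin
        conj (MT-φ j) * v j                     ≈⟨ *-congʳ (conj-cong (MT-φ-coordinate j)) ⟩
        conj (μ j * (e P j - e P′ j)) * v j     ≈⟨ *-congʳ (trans (conj-* _ _) (*-congˡ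
                                                     (trans (conj-sub _ _) (+-cong (conj-e P j) (-‿cong (conj-e P′ j)))))) ⟩
        (conj (μ j) * (e P j - e P′ j)) * v j   ≈⟨ solve 3 (λ a d w → (a :* d) :* w := d :* (a :* w))
                                                     refl (conj (μ j)) (e P j - e P′ j) (v j) ⟩
        (e P j - e P′ j) * f j                  ≈⟨ [y-z]x≈yx-zx (f j) (e P j) (e P′ j) ⟩
        e P j * f j - e P′ j * f j              ∎

module Character {c ℓ} (F : StarField c ℓ) (p : ℕ) {{_ : NonZero p}} (p-prime : Prime p)
  (ζ : StarField.Carrier F)
  (ζ^p≈1 : StarField._≈_ F (Construction._^_ F ζ p) (StarField.1# F))
  (ζ≉1 : ¬ StarField._≈_ F ζ (StarField.1# F))
  (ζ̄ζ≈1 : StarField._≈_ F (StarField._*_ F (StarField.conj F ζ) ζ) (StarField.1# F)) where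
  open StarField F
  open Construction F
  open StarFieldProperties F
  open ZMod p using ([_])
  open ResidueIndices F p using (sumF-shift; periodic-%; toℕ-[])
  open import Data.Nat.DivMod using (m≡m%n+[m/n]*n)
  open SetoidReasoning setoid
  open import Data.Integer as ℤ using (ℤ; +_; -[1+_]; _⊖_)
  import Data.Integer.Properties as ℤ
  import Data.Integer.DivMod as ℤ
  open import Data.Nat.Divisibility using (∣⇒≤)
  open import Data.Nat.Coprimality using (Coprime; coprime-Bézout)
  open import Data.Nat.GCD using (module Bézout)
  open import Data.Nat.Primality using (prime⇒irreducible)
  open import Data.Sum using (inj₁; inj₂)
  open import Data.Empty using (⊥-elim)
  open import Relation.Binary.Definitions using (tri<; tri≈; tri>)
  open import Data.Integer.Tactic.RingSolver using (solve-∀)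
  open import Algebra.Solver.Ring.NaturalCoefficients.Default commutativeSemiring
    using (solve; _:=_; _:*_)

  -- n ↦ ζⁿ on ℤ, using conj ζ = ζ⁻¹
  χ : ℤ → Carrier
  χ (+ n)    = ζ ^ n
  χ -[1+ n ] = conj ζ ^ suc n

  χ-⊖ : ∀ m n → χ (m ⊖ n) ≈ ζ ^ m * conj ζ ^ n
  χ-⊖ m zero = trans (reflexive (≡.cong χ (ℤ.⊖-≥ {m} {0} ℕ.z≤n))) (sym (*-identityʳ _))
  χ-⊖ zero (suc n) = trans (reflexive (≡.cong χ (ℤ.⊖-< {0} {suc n} (ℕ.s≤s ℕ.z≤n)))) (sym (*-identityˡ _))
  χ-⊖ (suc m) (suc n) = begin
    χ (suc m ⊖ suc n)                   ≡⟨ ≡.cong χ (ℤ.[1+m]⊖[1+n]≡m⊖n m n) ⟩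
    χ (m ⊖ n)                           ≈⟨ χ-⊖ m n ⟩
    ζ ^ m * conj ζ ^ n                  ≈⟨ *-identityˡ _ ⟨
    1# * (ζ ^ m * conj ζ ^ n)           ≈⟨ *-congʳ ζ̄ζ≈1 ⟨
    (conj ζ * ζ) * (ζ ^ m * conj ζ ^ n) ≈⟨ solve 4 (λ ζ̄ ζ x y → (ζ̄ :* ζ) :* (x :* y) := (ζ :* x) :* (ζ̄ :* y))
                                             refl (conj ζ) ζ (ζ ^ m) (conj ζ ^ n) ⟩
    (ζ * ζ ^ m) * (conj ζ * conj ζ ^ n) ∎

  χ-+ : ∀ x y → χ (x ℤ.+ y) ≈ χ x * χ y
  χ-+ (+ m)      (+ n)      = ^-+ ζ m n
  χ-+ (+ m)      -[1+ n ]   = χ-⊖ m (suc n)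
  χ-+ -[1+ m ]   (+ n)      = trans (χ-⊖ n (suc m)) (*-comm _ _)
  χ-+ -[1+ m ]   -[1+ n ]   = begin
    conj ζ ^ suc (suc (m ℕ.+ n))    ≡⟨ ≡.cong (λ k → conj ζ ^ suc k) (≡.sym (ℕ.+-suc m n)) ⟩
    conj ζ ^ (suc m ℕ.+ suc n)      ≈⟨ ^-+ (conj ζ) (suc m) (suc n) ⟩
    conj ζ ^ suc m * conj ζ ^ suc n ∎

  χ-‿ : ∀ x → χ (ℤ.- x) ≈ conj (χ x)
  χ-‿ (+ zero)  = sym conj-1
  χ-‿ (+ suc n) = sym (conj-^ ζ (suc n))
  χ-‿ -[1+ n ]  = trans (^-cong (suc n) (sym (conj-inv ζ))) (sym (conj-^ (conj ζ) (suc n)))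

  conj-χ*χ≈1 : ∀ x → conj (χ x) * χ x ≈ 1#
  conj-χ*χ≈1 x = begin
    conj (χ x) * χ x    ≈⟨ *-congʳ (χ-‿ x) ⟨
    χ (ℤ.- x) * χ x     ≈⟨ χ-+ (ℤ.- x) x ⟨
    χ (ℤ.- x ℤ.+ x)     ≡⟨ ≡.cong χ (ℤ.+-inverseˡ x) ⟩
    1#                  ∎

  χ-*ℕ : ∀ x n → χ (x ℤ.* + n) ≈ χ x ^ n
  χ-*ℕ x zero    = reflexive (≡.cong χ (ℤ.*-zeroʳ x))
  χ-*ℕ x (suc n) = begin
    χ (x ℤ.* + suc n)               ≡⟨ ≡.cong χ (≡.trans (≡.cong (x ℤ.*_) (ℤ.pos-+ 1 n)) (ℤ.*-distribˡ-+ x (+ 1) (+ n))) ⟩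
    χ (x ℤ.* + 1 ℤ.+ x ℤ.* + n)     ≈⟨ χ-+ (x ℤ.* + 1) (x ℤ.* + n) ⟩
    χ (x ℤ.* + 1) * χ (x ℤ.* + n)   ≈⟨ *-cong (reflexive (≡.cong χ (ℤ.*-identityʳ x))) (χ-*ℕ x n) ⟩
    χ x * χ x ^ n                   ∎

  χ-multiple : ∀ t → χ (t ℤ.* + p) ≈ 1#
  χ-multiple (+ n) = trans (reflexive (≡.cong χ (≡.sym (ℤ.pos-* n p)))) (^-multiple≈1 p ζ^p≈1 n)
  χ-multiple -[1+ n ] = begin
    χ (-[1+ n ] ℤ.* + p)       ≡⟨ ≡.cong χ (≡.sym (ℤ.neg-distribˡ-* (+ suc n) (+ p))) ⟩
    χ (ℤ.- (+ suc n ℤ.* + p))  ≈⟨ χ-‿ (+ suc n ℤ.* + p) ⟩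
    conj (χ (+ suc n ℤ.* + p)) ≈⟨ conj-cong (χ-multiple (+ suc n)) ⟩
    conj 1#                    ≈⟨ conj-1 ⟩
    1#                         ∎

  χ-^p≈1 : ∀ x → χ x ^ p ≈ 1#
  χ-^p≈1 x = trans (sym (χ-*ℕ x p)) (χ-multiple x)

  χ-periodic : ∀ {x} y t → x ≡ y ℤ.+ t ℤ.* + p → χ x ≈ χ y
  χ-periodic {x} y t x≡y+tp = begin
    χ x                     ≡⟨ ≡.cong χ x≡y+tp ⟩
    χ (y ℤ.+ t ℤ.* + p)     ≈⟨ χ-+ y (t ℤ.* + p) ⟩
    χ y * χ (t ℤ.* + p)     ≈⟨ *-congˡ (χ-multiple t) ⟩
    χ y * 1#                ≈⟨ *-identityʳ _ ⟩
    χ y                     ∎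

  ^-toℕ-[] : ∀ {w} → w ^ p ≈ 1# → ∀ N → w ^ toℕ [ N ] ≈ w ^ N
  ^-toℕ-[] {w} w^p≈1 N = begin
    w ^ toℕ [ N ]                         ≡⟨ ≡.cong (w ^_) (toℕ-[] N) ⟩
    w ^ (N % p)                           ≈⟨ *-identityʳ _ ⟨
    w ^ (N % p) * 1#                      ≈⟨ *-congˡ (^-multiple≈1 p w^p≈1 (N ℕ./ p)) ⟨
    w ^ (N % p) * w ^ (N ℕ./ p ℕ.* p)     ≈⟨ ^-+ w (N % p) _ ⟨
    w ^ (N % p ℕ.+ N ℕ./ p ℕ.* p)         ≡⟨ ≡.cong (w ^_) (m≡m%n+[m/n]*n N p) ⟨
    w ^ N                                 ∎

  p∤_ : ℤ → Set
  p∤ x = ∀ t → x ≢ t ℤ.* + p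

  p∤-small : ∀ x → 0 ℕ.< ℤ.∣ x ∣ → ℤ.∣ x ∣ ℕ.< p → p∤ x
  p∤-small x 0<∣x∣ ∣x∣<p t x≡tp with ℤ.∣ t ∣ | ≡.trans (≡.cong ℤ.∣_∣ x≡tp) (ℤ.abs-* t (+ p))
  ... | zero  | ∣x∣≡0    = ℕ.<⇒≢ 0<∣x∣ (≡.sym ∣x∣≡0)
  ... | suc k | ∣x∣≡p+kp = ℕ.<⇒≱ ∣x∣<p (ℕ.≤-trans (ℕ.m≤m+n p (k ℕ.* p)) (ℕ.≤-reflexive (≡.sym ∣x∣≡p+kp)))

  p∤-difference : ∀ {a b} → a ℕ.< p → b ℕ.< p → a ≢ b → p∤ (+ a ℤ.- + b)
  p∤-difference {a} {b} a<p b<p a≢b rewrite ℤ.m-n≡m⊖n a b with ℕ.<-cmp a b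
  ... | tri≈ _ a≡b _ = ⊥-elim (a≢b a≡b)
  ... | tri< a<b _ _ = p∤-small (a ⊖ b)
    (ℕ.≤-trans (ℕ.m<n⇒0<n∸m a<b) (ℕ.≤-reflexive (≡.sym (ℤ.∣⊖∣-< a<b))))
    (ℕ.≤-<-trans (ℕ.≤-reflexive (ℤ.∣⊖∣-< a<b)) (ℕ.≤-<-trans (ℕ.m∸n≤m b a) b<p))
  ... | tri> _ _ b<a = p∤-small (a ⊖ b)
    (ℕ.≤-trans (ℕ.m<n⇒0<n∸m b<a) (ℕ.≤-reflexive (≡.sym ∣a⊖b∣≡a∸b)))
    (ℕ.≤-<-trans (ℕ.≤-reflexive ∣a⊖b∣≡a∸b) (ℕ.≤-<-trans (ℕ.m∸n≤m a b) a<p))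
    where
    ∣a⊖b∣≡a∸b : ℤ.∣ a ⊖ b ∣ ≡ a ℕ.∸ b
    ∣a⊖b∣≡a∸b = ≡.trans (≡.cong ℤ.∣_∣ (ℤ.⊖-swap a b)) (≡.trans (ℤ.∣-i∣≡∣i∣ (b ⊖ a)) (ℤ.∣⊖∣-< b<a))

  p∤-+multiple : ∀ {x} → p∤ x → ∀ y → p∤ (x ℤ.+ y ℤ.* + p)
  p∤-+multiple {x} p∤x y t x+yp≡tp = p∤x (t ℤ.- y)
    (≡.trans (cancel x y (+ p)) (≡.trans (≡.cong (ℤ._- y ℤ.* + p) x+yp≡tp) (factor t y (+ p))))
    where
    cancel : ∀ x y P → x ≡ (x ℤ.+ y ℤ.* P) ℤ.- y ℤ.* P
    cancel = solve-∀
    factor : ∀ t y P → t ℤ.* P ℤ.- y ℤ.* P ≡ (t ℤ.- y) ℤ.* P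
    factor = solve-∀

  coprime-to-p : ∀ {t} → 0 ℕ.< t → t ℕ.< p → Coprime t p
  coprime-to-p {t} 0<t t<p (d∣t , d∣p) with prime⇒irreducible p-prime d∣p
  ... | inj₁ d≡1    = d≡1
  ... | inj₂ ≡.refl = ⊥-elim (ℕ.<⇒≱ t<p (∣⇒≤ {{ℕ.>-nonZero 0<t}} d∣t))

  ≈1-from-Bézout : ∀ {w m n} a b → w ^ m ≈ 1# → w ^ n ≈ 1# → 1 ℕ.+ a ℕ.* m ≡ b ℕ.* n → w ≈ 1#
  ≈1-from-Bézout {w} {m} {n} a b w^m≈1 w^n≈1 eq = begin
    w                      ≈⟨ *-identityʳ w ⟨
    w * 1#                 ≈⟨ *-congˡ (^-multiple≈1 m w^m≈1 a) ⟨
    w ^ (1 ℕ.+ a ℕ.* m)    ≡⟨ ≡.cong (w ^_) eq ⟩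
    w ^ (b ℕ.* n)          ≈⟨ ^-multiple≈1 n w^n≈1 b ⟩
    1#                     ∎

  root-order : ∀ {w t} → w ^ p ≈ 1# → ¬ w ≈ 1# → 0 ℕ.< t → t ℕ.< p → ¬ w ^ t ≈ 1#
  root-order w^p≈1 w≉1 0<t t<p w^t≈1 with coprime-Bézout (coprime-to-p 0<t t<p)
  ... | Bézout.+- x y eq = w≉1 (≈1-from-Bézout y x w^p≈1 w^t≈1 eq)
  ... | Bézout.-+ x y eq = w≉1 (≈1-from-Bézout x y w^t≈1 w^p≈1 eq)

  χ≉1 : ∀ {x} → p∤ x → ¬ χ x ≈ 1#
  χ≉1 {x} p∤x χx≈1 with x ℤ.%ℕ p | ℤ.a≡a%ℕn+[a/ℕn]*n x p | ℤ.n%ℕd<d x p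
  ... | zero  | x≡[x/p]p | _   = p∤x (x ℤ./ℕ p) (≡.trans x≡[x/p]p (ℤ.+-identityˡ _))
  ... | suc r | x≡r+[x/p]p | r<p = root-order ζ^p≈1 ζ≉1 (ℕ.s≤s ℕ.z≤n) r<p
    (trans (sym (χ-periodic (+ suc r) (x ℤ./ℕ p) x≡r+[x/p]p)) χx≈1)

  χ-*≉1 : ∀ {x t} → p∤ x → 0 ℕ.< t → t ℕ.< p → ¬ χ (x ℤ.* + t) ≈ 1#
  χ-*≉1 {x} {t} p∤x 0<t t<p χxt≈1 =
    root-order (χ-^p≈1 x) (χ≉1 p∤x) 0<t t<p (trans (sym (χ-*ℕ x t)) χxt≈1)

  characterSum : ∀ {x} → ¬ χ x ≈ 1# → sumF {p} (λ j → χ (x ℤ.* + toℕ j)) ≈ 0#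
  characterSum {x} χx≉1 =
    trans (sumF-cong {p} (λ j → χ-*ℕ x (toℕ j))) (powerSum-root {n = p} (χ-^p≈1 x) χx≉1)

  quadratic : ℤ → ℤ → ℤ → ℤ
  quadratic α β x = (α ℤ.* x ℤ.+ β) ℤ.* x

  quadratic-+p : ∀ α β x y → quadratic α β (x ℤ.+ + p) ℤ.+ y
                           ≡ (quadratic α β x ℤ.+ y) ℤ.+ (α ℤ.* (+ 2 ℤ.* x ℤ.+ + p) ℤ.+ β) ℤ.* + p
  quadratic-+p α β x y = identity α β x y (+ p)
    where
    identity : ∀ α β x y P → (α ℤ.* (x ℤ.+ P) ℤ.+ β) ℤ.* (x ℤ.+ P) ℤ.+ y
                           ≡ ((α ℤ.* x ℤ.+ β) ℤ.* x ℤ.+ y) ℤ.+ (α ℤ.* (+ 2 ℤ.* x ℤ.+ P) ℤ.+ β) ℤ.* P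
    identity = solve-∀

  quadratic-shift : ∀ α β t k → quadratic α β (t ℤ.+ k) ℤ.+ ℤ.- quadratic α β k
                              ≡ quadratic α β t ℤ.+ (+ 2 ℤ.* α ℤ.* t) ℤ.* k
  quadratic-shift = identity
    where
    identity : ∀ α β t k → (α ℤ.* (t ℤ.+ k) ℤ.+ β) ℤ.* (t ℤ.+ k) ℤ.+ ℤ.- ((α ℤ.* k ℤ.+ β) ℤ.* k)
                         ≡ (α ℤ.* t ℤ.+ β) ℤ.* t ℤ.+ (+ 2 ℤ.* α ℤ.* t) ℤ.* k
    identity = solve-∀

  gaussSum : ℤ → ℤ → Carrier
  gaussSum α β = sumF {p} (λ j → χ (quadratic α β (+ toℕ j)))

  gaussSum-correlation : ∀ α β k →
    sumF {p} (λ j → χ (quadratic α β (+ toℕ j) ℤ.+ ℤ.- quadratic α β (+ k)))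
      ≈ sumF {p} (λ t → χ (quadratic α β (+ toℕ t)) * χ (+ 2 ℤ.* α ℤ.* + toℕ t ℤ.* + k))
  gaussSum-correlation α β k = trans (sym (sumF-shift (λ j → g (toℕ j)) k)) (sumF-cong {p} substitute)
    where
    Q = quadratic α β
    g : ℕ → Carrier
    g n = χ (Q (+ n) ℤ.+ ℤ.- Q (+ k))
    g-periodic : ∀ n → g (n ℕ.+ p) ≈ g n
    g-periodic n = χ-periodic (Q (+ n) ℤ.+ ℤ.- Q (+ k)) (α ℤ.* (+ 2 ℤ.* + n ℤ.+ + p) ℤ.+ β)
      (≡.trans (≡.cong (λ z → Q z ℤ.+ ℤ.- Q (+ k)) (ℤ.pos-+ n p)) (quadratic-+p α β (+ n) _))
    substitute : ∀ t → g (toℕ [ toℕ t ℕ.+ k ]) ≈ χ (Q (+ toℕ t)) * χ (+ 2 ℤ.* α ℤ.* + toℕ t ℤ.* + k)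
    substitute t = begin
      g (toℕ [ toℕ t ℕ.+ k ])                          ≡⟨ ≡.cong g (toℕ-[] (toℕ t ℕ.+ k)) ⟩
      g ((toℕ t ℕ.+ k) % p)                            ≈⟨ periodic-% g g-periodic (toℕ t ℕ.+ k) ⟩
      g (toℕ t ℕ.+ k)                                  ≡⟨ ≡.cong χ (≡.trans (≡.cong (λ z → Q z ℤ.+ ℤ.- Q (+ k)) (ℤ.pos-+ (toℕ t) k))
                                                                           (quadratic-shift α β (+ toℕ t) (+ k))) ⟩
      χ (Q (+ toℕ t) ℤ.+ + 2 ℤ.* α ℤ.* + toℕ t ℤ.* + k) ≈⟨ χ-+ (Q (+ toℕ t)) _ ⟩
      χ (Q (+ toℕ t)) * χ (+ 2 ℤ.* α ℤ.* + toℕ t ℤ.* + k) ∎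

  -- after expanding G·Ḡ with gaussSum-correlation, only the t = 0 term survives the sum over k
  gaussSum-normSq : ∀ α β → p∤ (+ 2 ℤ.* α) → gaussSum α β * conj (gaussSum α β) ≈ fromℕ p
  gaussSum-normSq α β p∤2α = begin
    G * conj G                                    ≈⟨ *-congˡ (trans (conj-sumF {p} _) (sumF-cong {p} (λ k → sym (χ-‿ (Q k))))) ⟩
    G * sumF {p} (λ k → χ (ℤ.- Q k))              ≈⟨ sumF-*ˡ {p} G _ ⟨
    sumF {p} (λ k → G * χ (ℤ.- Q k))
      ≈⟨ sumF-cong {p} (λ k → trans (sumF-cong {p} (λ j → χ-+ (Q j) (ℤ.- Q k))) (sumF-*ʳ {p} _ _)) ⟨
    sumF {p} (λ k → sumF {p} (λ j → χ (Q j ℤ.+ ℤ.- Q k)))      ≈⟨ sumF-cong {p} (λ k → gaussSum-correlation α β (toℕ k)) ⟩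
    sumF {p} (λ k → sumF {p} (λ t → χ (Q t) * χ (2αt t ℤ.* + toℕ k))) ≈⟨ sumF-swap {p} {p} _ ⟩
    sumF {p} (λ t → sumF {p} (λ k → χ (Q t) * χ (2αt t ℤ.* + toℕ k))) ≈⟨ sumF-cong {p} (λ t → sumF-*ˡ {p} _ _) ⟩
    sumF {p} (λ t → χ (Q t) * sumF {p} (λ k → χ (2αt t ℤ.* + toℕ k))) ≈⟨ sumF-delta t₀ _ vanishes ⟩
    χ (Q t₀) * sumF {p} (λ k → χ (2αt t₀ ℤ.* + toℕ k))
      ≈⟨ *-cong (reflexive (≡.cong χ Q-t₀≡0)) (sumF-cong {p} (λ k → reflexive (≡.cong χ (2αt₀k≡0 k)))) ⟩
    1# * sumF {p} (λ _ → 1#)                      ≈⟨ trans (*-identityˡ _) (trans (sumF-const p 1#) (*-identityʳ _)) ⟩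
    fromℕ p                                       ∎
    where
    G = gaussSum α β
    Q : Fin p → ℤ
    Q j = quadratic α β (+ toℕ j)
    2αt : Fin p → ℤ
    2αt t = + 2 ℤ.* α ℤ.* + toℕ t
    t₀ : Fin p
    t₀ = Fin.fromℕ< (ℕ.>-nonZero⁻¹ p)
    Q-t₀≡0 : Q t₀ ≡ + 0
    Q-t₀≡0 = ≡.trans (≡.cong (λ n → quadratic α β (+ n)) (Fin.toℕ-fromℕ< _)) (ℤ.*-zeroʳ (α ℤ.* + 0 ℤ.+ β))
    2αt₀k≡0 : ∀ k → 2αt t₀ ℤ.* + toℕ k ≡ + 0
    2αt₀k≡0 k = ≡.trans (≡.cong (λ n → + 2 ℤ.* α ℤ.* + n ℤ.* + toℕ k) (Fin.toℕ-fromℕ< _))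
                        (≡.trans (≡.cong (ℤ._* + toℕ k) (ℤ.*-zeroʳ (+ 2 ℤ.* α))) (ℤ.*-zeroˡ (+ toℕ k)))
    vanishes : ∀ t → t ≢ t₀ → χ (Q t) * sumF {p} (λ k → χ (2αt t ℤ.* + toℕ k)) ≈ 0#
    vanishes t t≢t₀ = trans (*-congˡ (characterSum {2αt t} (χ-*≉1 {+ 2 ℤ.* α} p∤2α 0<t (Fin.toℕ<n t)))) (zeroʳ _)
      where
      0<t : 0 ℕ.< toℕ t
      0<t = ℕ.n≢0⇒n>0 (λ t≡0 → t≢t₀ (Fin.toℕ-injective (≡.trans t≡0 (≡.sym (Fin.toℕ-fromℕ< _)))))

module HalfResidues {c ℓ} (F : StarField c ℓ) (p : ℕ) {{_ : NonZero p}} (p-prime : Prime p) (p-odd : p % 2 ≡ 1) where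
  open ResidueIndices F p
  open import Data.Nat.DivMod using (m≡m%n+[m/n]*n; m*n/n≡m)
  open import Data.Nat.Primality using (prime⇒nonTrivial)
  open import Data.Sum using (_⊎_; inj₁; inj₂)
  open import Data.Empty using (⊥-elim)
  open import Relation.Binary.Definitions using (tri<; tri≈; tri>)

  private
    q = p ℕ./ 2
    p≡1+q*2 : p ≡ suc (q ℕ.* 2)
    p≡1+q*2 = ≡.trans (m≡m%n+[m/n]*n p 2) (≡.cong (ℕ._+ q ℕ.* 2) p-odd)
    h≡q : h ≡ q
    h≡q = ≡.trans (≡.cong (λ x → (x ℕ.∸ 1) ℕ./ 2) p≡1+q*2) (m*n/n≡m q 2)

  p≡1+2h : p ≡ suc (h ℕ.+ h)
  p≡1+2h = ≡.trans p≡1+q*2 (≡.cong suc (≡.trans (ℕ.*-comm q 2)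
    (≡.trans (≡.cong (q ℕ.+_) (ℕ.+-identityʳ q)) (≡.cong₂ ℕ._+_ (≡.sym h≡q) (≡.sym h≡q)))))

  p∸1≡2h : p ℕ.∸ 1 ≡ h ℕ.+ h
  p∸1≡2h = ≡.cong (ℕ._∸ 1) p≡1+2h

  [p+1]/2≡1+h : (p ℕ.+ 1) ℕ./ 2 ≡ suc h
  [p+1]/2≡1+h = ≡.trans (≡.cong (λ x → (x ℕ.+ 1) ℕ./ 2) p≡1+q*2)
    (≡.trans (≡.cong (ℕ._/ 2) (ℕ.+-comm (suc (q ℕ.* 2)) 1)) (≡.trans (m*n/n≡m (suc q) 2) (≡.cong suc (≡.sym h≡q))))

  0<h : 0 ℕ.< h
  0<h with h | p≡1+2h
  ... | zero  | p≡1 = ⊥-elim (ℕ.<-irrefl (≡.sym p≡1) (ℕ.nonTrivial⇒n>1 p {{prime⇒nonTrivial p-prime}}))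
  ... | suc _ | _   = ℕ.s≤s ℕ.z≤n

  h<p : h ℕ.< p
  h<p = ℕ.≤-trans (ℕ.s≤s (ℕ.m≤m+n h h)) (ℕ.≤-reflexive (≡.sym p≡1+2h))

  1<p : 1 ℕ.< p
  1<p = ℕ.≤-trans (ℕ.s≤s 0<h) h<p

  mirror<p : ∀ d → mirror d ℕ.< p
  mirror<p d = ℕ.≤-<-trans (ℕ.m∸n≤m (p ℕ.∸ 1) d) (ℕ.≤-reflexive (ℕ.suc-pred p))

  mirror+d≡2h : ∀ {d} → d ℕ.< p → mirror d ℕ.+ d ≡ h ℕ.+ h
  mirror+d≡2h d<p = ≡.trans (ℕ.m∸n+n≡m (ℕ.<⇒≤pred d<p)) p∸1≡2h

  mirror-involutive : ∀ {d} → d ℕ.< p → mirror (mirror d) ≡ d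
  mirror-involutive d<p = ℕ.m∸[m∸n]≡n (ℕ.<⇒≤pred d<p)

  h<mirror : ∀ {i} → i ℕ.< h → h ℕ.< mirror i
  h<mirror {i} i<h = ℕ.+-cancelʳ-< i h (mirror i)
    (ℕ.<-≤-trans (ℕ.+-monoʳ-< h i<h) (ℕ.≤-reflexive (≡.sym (mirror+d≡2h (ℕ.<-trans i<h h<p)))))

  mirror<h : ∀ {d} → h ℕ.< d → d ℕ.< p → mirror d ℕ.< h
  mirror<h {d} h<d d<p = ℕ.+-cancelʳ-< d (mirror d) h
    (ℕ.≤-<-trans (ℕ.≤-reflexive (mirror+d≡2h d<p)) (ℕ.+-monoʳ-< h h<d))

  pos-cover : ∀ k j → j ≢ pos k h →
    Σ (Fin h) (λ i → j ≡ pos k (toℕ i) ⊎ j ≡ pos k (mirror (toℕ i)))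
  pos-cover k j j≢pos-h with ℕ.<-cmp (offset k j) h
  ... | tri< d<h _ _ = Fin.fromℕ< d<h , inj₁ (≡.trans (≡.sym (pos-offset k j))
                          (≡.cong (pos k) (≡.sym (Fin.toℕ-fromℕ< d<h))))
  ... | tri≈ _ d≡h _ = ⊥-elim (j≢pos-h (≡.trans (≡.sym (pos-offset k j)) (≡.cong (pos k) d≡h)))
  ... | tri> _ _ h<d = Fin.fromℕ< m<h , inj₂ (≡.trans (≡.sym (pos-offset k j))
                          (≡.cong (pos k) (≡.sym (≡.trans (≡.cong mirror (Fin.toℕ-fromℕ< m<h))
                                                          (mirror-involutive (offset<p k j))))))
    where
    m<h : mirror (offset k j) ℕ.< h
    m<h = mirror<h h<d (offset<p k j)

module MutuallyUnbiasedBases {c ℓ} (F : StarField c ℓ) (p : ℕ) {{_ : NonZero p}}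
  (p-prime : Prime p) (p-odd : p % 2 ≡ 1)
  (ζ s : StarField.Carrier F)
  (ζ^p≈1 : StarField._≈_ F (Construction._^_ F ζ p) (StarField.1# F))
  (ζ≉1 : ¬ StarField._≈_ F ζ (StarField.1# F))
  (ζ̄ζ≈1 : StarField._≈_ F (StarField._*_ F (StarField.conj F ζ) ζ) (StarField.1# F))
  (s̄≈s : StarField._≈_ F (StarField.conj F s) s)
  (ps²≈1 : StarField._≈_ F (StarField._*_ F (Construction.fromℕ F p) (StarField._*_ F s s)) (StarField.1# F)) where
  open StarField F
  open Construction F
  open ZMod p
  open StarFieldProperties F
  open InnerProductProperties F {p}
  open ResidueIndices F p
  open HalfResidues F p p-prime p-odd
  open Character F p p-prime ζ ζ^p≈1 ζ≉1 ζ̄ζ≈1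
  open SetoidReasoning setoid
  open import Data.Integer as ℤ using (ℤ; +_; _⊖_)
  import Data.Integer.Properties as ℤ
  open import Data.Integer.Tactic.RingSolver using (solve-∀)
  open import Relation.Nullary using (yes; no)
  open import Data.Sum using (inj₁; inj₂)
  open import Data.Empty using (⊥-elim)
  open import Algebra.Properties.AbelianGroup +-abelianGroup using (x≈y⇒x∙y⁻¹≈ε; x∙y⁻¹≈ε⇒x≈y)
  open import Algebra.Properties.Ring ring using ([y-z]x≈yx-zx)
  open import Algebra.Solver.Ring.NaturalCoefficients.Default commutativeSemiring
    using (solve; _:=_; _:*_)

  Hℤ : ℤ
  Hℤ = + 1 ℤ.+ + h

  +p≡1+2h : + p ≡ + 1 ℤ.+ (+ h ℤ.+ + h)
  +p≡1+2h = ≡.trans (≡.cong +_ p≡1+2h) (≡.trans (ℤ.pos-+ 1 (h ℕ.+ h)) (≡.cong (λ z → + 1 ℤ.+ z) (ℤ.pos-+ h h)))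

  χ-periodic-1+2h : ∀ {x} y t → x ≡ y ℤ.+ t ℤ.* (+ 1 ℤ.+ (+ h ℤ.+ + h)) → χ x ≈ χ y
  χ-periodic-1+2h y t x≡y+tp = χ-periodic y t (≡.trans x≡y+tp (≡.cong (λ P → y ℤ.+ t ℤ.* P) (≡.sym +p≡1+2h)))

  -- the exponent of η^{(β_{a,b})}, with (p + 1)/2 = 1 + h
  phase : Fin p → Fin p → ℤ → ℤ
  phase a b x = Hℤ ℤ.* x ℤ.* (+ toℕ a ℤ.* x ℤ.+ + 2 ℤ.* + toℕ b ℤ.+ + toℕ a)

  ηℓ : Fin p → Fin p → Vec p
  ηℓ a b = η ζ s (βl a b)

  phase-ℕ : ∀ a b n → + ((p ℕ.+ 1) ℕ./ 2 ℕ.* n ℕ.* (toℕ a ℕ.* n ℕ.+ 2 ℕ.* toℕ b ℕ.+ toℕ a)) ≡ phase a b (+ n)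
  phase-ℕ a b n = ≡.trans (ℤ.pos-* ((p ℕ.+ 1) ℕ./ 2 ℕ.* n) _) (≡.cong₂ ℤ._*_
    (≡.trans (ℤ.pos-* ((p ℕ.+ 1) ℕ./ 2) n) (≡.cong (λ H → H ℤ.* + n) (≡.trans (≡.cong +_ [p+1]/2≡1+h) (ℤ.pos-+ 1 h))))
    (≡.trans (ℤ.pos-+ (A ℕ.* n ℕ.+ 2 ℕ.* B) A) (≡.cong (ℤ._+ + A)
      (≡.trans (ℤ.pos-+ (A ℕ.* n) (2 ℕ.* B)) (≡.cong₂ ℤ._+_ (ℤ.pos-* A n) (ℤ.pos-* 2 B))))))
    where
    A = toℕ a
    B = toℕ b

  ηℓ-χ : ∀ a b j → ηℓ a b j ≈ s * χ (phase a b (+ toℕ j))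
  ηℓ-χ a b j = *-congˡ (reflexive (≡.cong χ (phase-ℕ a b (toℕ j))))

  -- Orthonormality and unbiasedness

  conj-sχ*sχ : ∀ x y → conj (s * χ x) * (s * χ y) ≈ (s * s) * χ (ℤ.- x ℤ.+ y)
  conj-sχ*sχ x y = begin
    conj (s * χ x) * (s * χ y)     ≈⟨ *-congʳ (trans (conj-* s (χ x)) (*-cong s̄≈s (sym (χ-‿ x)))) ⟩
    (s * χ (ℤ.- x)) * (s * χ y)    ≈⟨ solve 3 (λ s a b → (s :* a) :* (s :* b) := (s :* s) :* (a :* b)) refl s (χ (ℤ.- x)) (χ y) ⟩
    (s * s) * (χ (ℤ.- x) * χ y)    ≈⟨ *-congˡ (χ-+ (ℤ.- x) y) ⟨
    (s * s) * χ (ℤ.- x ℤ.+ y)      ∎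

  normSq-sχ : ∀ x → conj (s * χ x) * (s * χ x) ≈ s * s
  normSq-sχ x = trans (conj-sχ*sχ x x) (trans (*-congˡ (reflexive (≡.cong χ (ℤ.+-inverseˡ x)))) (*-identityʳ _))

  conj-ηℓ*ηℓ : ∀ a b a′ b′ i j → conj (ηℓ a b i) * ηℓ a′ b′ j ≈
    (s * s) * χ (ℤ.- phase a b (+ toℕ i) ℤ.+ phase a′ b′ (+ toℕ j))
  conj-ηℓ*ηℓ a b a′ b′ i j = trans (*-cong (conj-cong (ηℓ-χ a b i)) (ηℓ-χ a′ b′ j))
    (conj-sχ*sχ (phase a b (+ toℕ i)) (phase a′ b′ (+ toℕ j)))

  normSq-ηℓ : ∀ a b i → conj (ηℓ a b i) * ηℓ a b i ≈ s * s
  normSq-ηℓ a b i = trans (*-cong (conj-cong (ηℓ-χ a b i)) (ηℓ-χ a b i)) (normSq-sχ (phase a b (+ toℕ i)))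

  ⟨ηℓ,ηℓ⟩ : ∀ a b a′ b′ → ⟨ ηℓ a b , ηℓ a′ b′ ⟩ ≈
    (s * s) * sumF {p} (λ j → χ (ℤ.- phase a b (+ toℕ j) ℤ.+ phase a′ b′ (+ toℕ j)))
  ⟨ηℓ,ηℓ⟩ a b a′ b′ = trans
    (sumF-cong {p} (λ j → conj-ηℓ*ηℓ a b a′ b′ j j))
    (sumF-*ˡ {p} (s * s) _)

  ‖η‖≈1 : ∀ β → ⟨ η ζ s β , η ζ s β ⟩ ≈ 1#
  ‖η‖≈1 (βv k)   = trans (⟨e,⟩ m (e m)) (reflexive (e-≡ m m ≡.refl))
    where m = [ toℕ k ℕ.+ h ]
  ‖η‖≈1 (βl a b) = begin
    ⟨ ηℓ a b , ηℓ a b ⟩   ≈⟨ sumF-cong {p} (normSq-ηℓ a b) ⟩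
    sumF {p} (λ _ → s * s) ≈⟨ sumF-const p (s * s) ⟩
    fromℕ p * (s * s)      ≈⟨ ps²≈1 ⟩
    1#                     ∎

  ηv⊥ηv : ∀ {k k′} → k ≢ k′ → ⟨ η ζ s (βv k) , η ζ s (βv k′) ⟩ ≈ 0#
  ηv⊥ηv {k} {k′} k≢k′ = trans (⟨e,⟩ [ toℕ k ℕ.+ h ] _) (reflexive (e-≢ [ toℕ k′ ℕ.+ h ] [ toℕ k ℕ.+ h ] (λ eq →
    k≢k′ (Fin.toℕ-injective ([]-injective h (Fin.toℕ<n k) (Fin.toℕ<n k′) (≡.sym (Fin.toℕ-injective eq)))))))

  ηℓ⊥ηℓ : ∀ {a b b′} → b ≢ b′ → ⟨ ηℓ a b , ηℓ a b′ ⟩ ≈ 0#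
  ηℓ⊥ηℓ {a} {b} {b′} b≢b′ = begin
    ⟨ ηℓ a b , ηℓ a b′ ⟩                                    ≈⟨ ⟨ηℓ,ηℓ⟩ a b a b′ ⟩
    (s * s) * sumF {p} (λ j → χ (ℤ.- phase a b (+ toℕ j) ℤ.+ phase a b′ (+ toℕ j)))
      ≈⟨ *-congˡ (sumF-cong {p} (λ j → χ-periodic-1+2h (B ℤ.* + toℕ j) (+ toℕ j ℤ.* B)
                                   (identity (+ h) (+ toℕ a) (+ toℕ b) (+ toℕ b′) (+ toℕ j)))) ⟩
    (s * s) * sumF {p} (λ j → χ (B ℤ.* + toℕ j))            ≈⟨ *-congˡ (characterSum {B} (χ≉1 p∤B)) ⟩
    (s * s) * 0#                                            ≈⟨ zeroʳ _ ⟩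
    0#                                                      ∎
    where
    B = + toℕ b′ ℤ.- + toℕ b
    p∤B : p∤ B
    p∤B = p∤-difference (Fin.toℕ<n b′) (Fin.toℕ<n b) (λ eq → b≢b′ (Fin.toℕ-injective (≡.sym eq)))
    identity : ∀ h a b b′ x →
      ℤ.- ((+ 1 ℤ.+ h) ℤ.* x ℤ.* (a ℤ.* x ℤ.+ + 2 ℤ.* b ℤ.+ a)) ℤ.+ (+ 1 ℤ.+ h) ℤ.* x ℤ.* (a ℤ.* x ℤ.+ + 2 ℤ.* b′ ℤ.+ a)
        ≡ (b′ ℤ.- b) ℤ.* x ℤ.+ (x ℤ.* (b′ ℤ.- b)) ℤ.* (+ 1 ℤ.+ (h ℤ.+ h))
    identity = solve-∀

  unbiased-swap : ∀ (u v : Vec p) → ⟨ u , v ⟩ * conj ⟨ u , v ⟩ ≈ s * s → ⟨ v , u ⟩ * conj ⟨ v , u ⟩ ≈ s * s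
  unbiased-swap u v uv≈s² = begin
    ⟨ v , u ⟩ * conj ⟨ v , u ⟩                  ≈⟨ *-cong (⟨⟩-swap u v) (conj-cong (⟨⟩-swap u v)) ⟩
    conj ⟨ u , v ⟩ * conj (conj ⟨ u , v ⟩)      ≈⟨ trans (*-congˡ (conj-inv _)) (*-comm _ _) ⟩
    ⟨ u , v ⟩ * conj ⟨ u , v ⟩                  ≈⟨ uv≈s² ⟩
    s * s                                       ∎

  ηv-ηℓ-unbiased : ∀ k a b → ⟨ η ζ s (βv k) , ηℓ a b ⟩ * conj ⟨ η ζ s (βv k) , ηℓ a b ⟩ ≈ s * s
  ηv-ηℓ-unbiased k a b = trans (*-cong ⟨e,ηℓ⟩ (conj-cong ⟨e,ηℓ⟩)) (trans (*-comm _ _) (normSq-sχ (phase a b (+ toℕ m))))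
    where
    m = [ toℕ k ℕ.+ h ]
    ⟨e,ηℓ⟩ : ⟨ η ζ s (βv k) , ηℓ a b ⟩ ≈ s * χ (phase a b (+ toℕ m))
    ⟨e,ηℓ⟩ = trans (⟨e,⟩ m (ηℓ a b)) (ηℓ-χ a b m)

  ηℓ-ηℓ-unbiased : ∀ {a a′} b b′ → a ≢ a′ → ⟨ ηℓ a b , ηℓ a′ b′ ⟩ * conj ⟨ ηℓ a b , ηℓ a′ b′ ⟩ ≈ s * s
  ηℓ-ηℓ-unbiased {a} {a′} b b′ a≢a′ = begin
    z * conj z                                  ≈⟨ *-cong z≈s²G (conj-cong z≈s²G) ⟩
    ((s * s) * G) * conj ((s * s) * G)          ≈⟨ *-congˡ (trans (conj-* _ _) (*-congʳ (trans (conj-* s s) (*-cong s̄≈s s̄≈s)))) ⟩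
    ((s * s) * G) * ((s * s) * conj G)          ≈⟨ solve 3 (λ s g ḡ → ((s :* s) :* g) :* ((s :* s) :* ḡ) := (s :* s) :* ((g :* ḡ) :* (s :* s)))
                                                      refl s G (conj G) ⟩
    (s * s) * ((G * conj G) * (s * s))          ≈⟨ *-congˡ (trans (*-congʳ (gaussSum-normSq α β p∤2α)) ps²≈1) ⟩
    (s * s) * 1#                                ≈⟨ *-identityʳ _ ⟩
    s * s                                       ∎
    where
    A = + toℕ a′ ℤ.- + toℕ a
    α = Hℤ ℤ.* A
    β = Hℤ ℤ.* (+ 2 ℤ.* (+ toℕ b′ ℤ.- + toℕ b) ℤ.+ A)
    G = gaussSum α β
    z = ⟨ ηℓ a b , ηℓ a′ b′ ⟩
    difference : ∀ h a b a′ b′ x →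
      ℤ.- ((+ 1 ℤ.+ h) ℤ.* x ℤ.* (a ℤ.* x ℤ.+ + 2 ℤ.* b ℤ.+ a))
        ℤ.+ (+ 1 ℤ.+ h) ℤ.* x ℤ.* (a′ ℤ.* x ℤ.+ + 2 ℤ.* b′ ℤ.+ a′)
        ≡ ((+ 1 ℤ.+ h) ℤ.* (a′ ℤ.- a) ℤ.* x ℤ.+ (+ 1 ℤ.+ h) ℤ.* (+ 2 ℤ.* (b′ ℤ.- b) ℤ.+ (a′ ℤ.- a))) ℤ.* x
    difference = solve-∀
    doubled : ∀ h A → + 2 ℤ.* ((+ 1 ℤ.+ h) ℤ.* A) ≡ A ℤ.+ A ℤ.* (+ 1 ℤ.+ (h ℤ.+ h))
    doubled = solve-∀
    p∤2α : p∤ (+ 2 ℤ.* α)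
    p∤2α t 2α≡tp = p∤-+multiple (p∤-difference (Fin.toℕ<n a′) (Fin.toℕ<n a) (λ eq → a≢a′ (Fin.toℕ-injective (≡.sym eq))))
      A t (≡.trans (≡.cong (λ P → A ℤ.+ A ℤ.* P) +p≡1+2h) (≡.trans (≡.sym (doubled (+ h) A)) 2α≡tp))
    z≈s²G : z ≈ (s * s) * G
    z≈s²G = trans (⟨ηℓ,ηℓ⟩ a b a′ b′) (*-congˡ (sumF-cong {p} (λ j →
      reflexive (≡.cong χ (difference (+ h) (+ toℕ a) (+ toℕ b) (+ toℕ a′) (+ toℕ b′) (+ toℕ j))))))

  -- Spanning

  complete⇒InSpan : ∀ {I : Set} (g : I → Vec p) (y : Fin p → I) →
    (∀ i j → sumF {p} (λ b → conj (g (y b) i) * g (y b) j) ≈ e i j) → ∀ v → InSpan g v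
  complete⇒InSpan g y complete v = tabulate (λ b → ⟨ g (y b) , v ⟩ , y b) , λ j → sym (begin
    lincomb g (tabulate (λ b → ⟨ g (y b) , v ⟩ , y b)) j     ≈⟨ lincomb-tabulate g _ y j ⟩
    sumF {p} (λ b → ⟨ g (y b) , v ⟩ * g (y b) j)             ≈⟨ expansion (λ b → g (y b)) v j ⟩
    sumF {p} (λ i → v i * sumF {p} (λ b → conj (g (y b) i) * g (y b) j)) ≈⟨ sumF-cong {p} (λ i → *-congˡ (complete i j)) ⟩
    sumF {p} (λ i → v i * e i j)                             ≈⟨ sumF-cong {p} (λ i → trans (*-comm _ _) (*-congʳ (reflexive (e-sym i j)))) ⟩
    sumF {p} (λ i → e j i * v i)                             ≈⟨ sumF-e j v ⟩
    v j                                                      ∎)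

  ηv-complete : ∀ i j → sumF {p} (λ k → conj (η ζ s (βv k) i) * η ζ s (βv k) j) ≈ e i j
  ηv-complete i j = begin
    sumF {p} (λ k → K [ toℕ k ℕ.+ h ])   ≈⟨ sumF-shift K h ⟩
    sumF {p} K                           ≈⟨ sumF-cong {p} (λ m → *-congʳ (trans (conj-e m i) (reflexive (e-sym m i)))) ⟩
    sumF {p} (λ m → e i m * e m j)       ≈⟨ sumF-e i (λ m → e m j) ⟩
    e i j                                ∎
    where
    K : Fin p → Carrier
    K m = conj (e m i) * e m j

  ηℓ-complete : ∀ a i j → sumF {p} (λ b → conj (ηℓ a b i) * ηℓ a b j) ≈ e i j
  ηℓ-complete a i j with i Fin.≟ j
  ... | yes ≡.refl = begin
    sumF {p} (λ b → conj (ηℓ a b i) * ηℓ a b i) ≈⟨ sumF-cong {p} (λ b → normSq-ηℓ a b i) ⟩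
    sumF {p} (λ _ → s * s)                      ≈⟨ trans (sumF-const p (s * s)) ps²≈1 ⟩
    1#                                          ≈⟨ reflexive (e-≡ i i ≡.refl) ⟨
    e i i                                       ∎
  ... | no i≢j = begin
    sumF {p} (λ b → conj (ηℓ a b i) * ηℓ a b j)
      ≈⟨ sumF-cong {p} (λ b → conj-ηℓ*ηℓ a b a b i j) ⟩
    sumF {p} (λ b → (s * s) * χ (ℤ.- phase a b (+ toℕ i) ℤ.+ phase a b (+ toℕ j)))
      ≈⟨ sumF-cong {p} (λ b → *-congˡ (trans
           (χ-periodic-1+2h (c₀ ℤ.+ D ℤ.* + toℕ b) (+ toℕ b ℤ.* D) (identity (+ h) (+ toℕ a) (+ toℕ b) (+ toℕ i) (+ toℕ j)))
           (χ-+ c₀ _))) ⟩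
    sumF {p} (λ b → (s * s) * (χ c₀ * χ (D ℤ.* + toℕ b)))
      ≈⟨ trans (sumF-*ˡ {p} (s * s) _) (*-congˡ (sumF-*ˡ {p} (χ c₀) _)) ⟩
    (s * s) * (χ c₀ * sumF {p} (λ b → χ (D ℤ.* + toℕ b)))
      ≈⟨ *-congˡ (*-congˡ (characterSum {D} (χ≉1 (p∤-difference (Fin.toℕ<n j) (Fin.toℕ<n i)
                                                 (λ eq → i≢j (Fin.toℕ-injective (≡.sym eq))))))) ⟩
    (s * s) * (χ c₀ * 0#)                     ≈⟨ trans (*-congˡ (zeroʳ _)) (zeroʳ _) ⟩
    0#                                        ≈⟨ reflexive (e-≢ i j (λ eq → i≢j (Fin.toℕ-injective eq))) ⟨
    e i j                                     ∎
    where
    D = + toℕ j ℤ.- + toℕ i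
    c₀ = ℤ.- (Hℤ ℤ.* + toℕ i ℤ.* (+ toℕ a ℤ.* + toℕ i ℤ.+ + toℕ a))
           ℤ.+ Hℤ ℤ.* + toℕ j ℤ.* (+ toℕ a ℤ.* + toℕ j ℤ.+ + toℕ a)
    identity : ∀ h a b i j →
      ℤ.- ((+ 1 ℤ.+ h) ℤ.* i ℤ.* (a ℤ.* i ℤ.+ + 2 ℤ.* b ℤ.+ a)) ℤ.+ (+ 1 ℤ.+ h) ℤ.* j ℤ.* (a ℤ.* j ℤ.+ + 2 ℤ.* b ℤ.+ a)
        ≡ ((ℤ.- ((+ 1 ℤ.+ h) ℤ.* i ℤ.* (a ℤ.* i ℤ.+ a)) ℤ.+ (+ 1 ℤ.+ h) ℤ.* j ℤ.* (a ℤ.* j ℤ.+ a)) ℤ.+ (j ℤ.- i) ℤ.* b)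
          ℤ.+ (b ℤ.* (j ℤ.- i)) ℤ.* (+ 1 ℤ.+ (h ℤ.+ h))
    identity = solve-∀

  η-spans : ∀ C v → InSpan (λ (βc : Σ Block (λ β → classOf β ≡ C)) → η ζ s (proj₁ βc)) v
  η-spans vert      = complete⇒InSpan _ (λ k → βv k , ≡.refl) ηv-complete
  η-spans (slope a) = complete⇒InSpan _ (λ b → βl a b , ≡.refl) (ηℓ-complete a)

  -- The orthogonal complement of the generators

  centre≡pos-h : ∀ k → [ toℕ k ℕ.+ h ] ≡ pos k h
  centre≡pos-h k = ≡.cong [_] (ℕ.+-comm (toℕ k) h)

  e-pos-≢ : ∀ k {x y} → x ℕ.< p → y ℕ.< p → x ≢ y → e (pos k x) (pos k y) ≡ 0#
  e-pos-≢ k x<p y<p x≢y = e-≢ _ _ (λ eq → x≢y (pos-injective k x<p y<p (Fin.toℕ-injective eq)))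

  x≈0∧y≈0⇒x-y≈0 : ∀ {x y} → x ≈ 0# → y ≈ 0# → x - y ≈ 0#
  x≈0∧y≈0⇒x-y≈0 x≈0 y≈0 = x≈y⇒x∙y⁻¹≈ε (trans x≈0 (sym y≈0))

  module SlopeGenerator (a b k : Fin p) where
    κ : Fin p
    κ = [ toℕ a ℕ.* toℕ k ℕ.+ toℕ b ]

    A B L : ℤ
    A = + toℕ a
    B = + toℕ b
    L = A ℤ.* + toℕ k ℤ.+ B

    μ≈χ : ∀ x → (ζ ^ x) ^ toℕ κ ≈ χ (L ℤ.* + x)
    μ≈χ x = begin
      (ζ ^ x) ^ toℕ κ   ≈⟨ ^-toℕ-[] (χ-^p≈1 (+ x)) N ⟩
      (ζ ^ x) ^ N       ≈⟨ ^-* ζ N x ⟨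
      χ (+ (N ℕ.* x))   ≡⟨ ≡.cong χ (≡.trans (ℤ.pos-* N x)
                             (≡.cong (ℤ._* + x) (≡.trans (ℤ.pos-+ _ (toℕ b)) (≡.cong (ℤ._+ + toℕ b) (ℤ.pos-* (toℕ a) (toℕ k)))))) ⟩
      χ (L ℤ.* + x)     ∎
      where N = toℕ a ℕ.* toℕ k ℕ.+ toℕ b

    Ψℤ : ℤ → ℤ
    Ψℤ x = ℤ.- (L ℤ.* x) ℤ.+ phase a b x

    Ψ : ℕ → Carrier
    Ψ n = χ (Ψℤ (+ n))

    conj-μ*ηℓ : ∀ m → conj ((ζ ^ toℕ m) ^ toℕ κ) * ηℓ a b m ≈ s * Ψ (toℕ m)
    conj-μ*ηℓ m = begin
      conj ((ζ ^ toℕ m) ^ toℕ κ) * ηℓ a b m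
        ≈⟨ *-cong (trans (conj-cong (μ≈χ (toℕ m))) (sym (χ-‿ (L ℤ.* + toℕ m)))) (ηℓ-χ a b m) ⟩
      χ (ℤ.- (L ℤ.* + toℕ m)) * (s * χ φm)      ≈⟨ solve 3 (λ x s y → x :* (s :* y) := s :* (x :* y)) refl _ s _ ⟩
      s * (χ (ℤ.- (L ℤ.* + toℕ m)) * χ φm)      ≈⟨ *-congˡ (χ-+ (ℤ.- (L ℤ.* + toℕ m)) φm) ⟨
      s * Ψ (toℕ m)                             ∎
      where φm = phase a b (+ toℕ m)

    Ψ-periodic : ∀ n → Ψ (n ℕ.+ p) ≈ Ψ n
    Ψ-periodic n = begin
      Ψ (n ℕ.+ p)                                 ≡⟨ ≡.cong (λ x → χ (Ψℤ x))
                                                        (≡.trans (ℤ.pos-+ n p) (≡.cong (λ P → + n ℤ.+ P) +p≡1+2h)) ⟩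
      χ (Ψℤ X)
        ≈⟨ χ-periodic-1+2h (Ψℤ (+ n)) (Hℤ ℤ.* (A ℤ.* (+ 2 ℤ.* + n ℤ.+ (+ 1 ℤ.+ (+ h ℤ.+ + h))) ℤ.+ + 2 ℤ.* B ℤ.+ A) ℤ.- L)
                           (identity (+ h) A B L (+ n)) ⟩
      Ψ n                                         ∎
      where
      X = + n ℤ.+ (+ 1 ℤ.+ (+ h ℤ.+ + h))
      identity : ∀ h a b L x →
        ℤ.- (L ℤ.* (x ℤ.+ (+ 1 ℤ.+ (h ℤ.+ h))))
          ℤ.+ (+ 1 ℤ.+ h) ℤ.* (x ℤ.+ (+ 1 ℤ.+ (h ℤ.+ h))) ℤ.* (a ℤ.* (x ℤ.+ (+ 1 ℤ.+ (h ℤ.+ h))) ℤ.+ + 2 ℤ.* b ℤ.+ a)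
          ≡ (ℤ.- (L ℤ.* x) ℤ.+ (+ 1 ℤ.+ h) ℤ.* x ℤ.* (a ℤ.* x ℤ.+ + 2 ℤ.* b ℤ.+ a))
            ℤ.+ ((+ 1 ℤ.+ h) ℤ.* (a ℤ.* (+ 2 ℤ.* x ℤ.+ (+ 1 ℤ.+ (h ℤ.+ h))) ℤ.+ + 2 ℤ.* b ℤ.+ a) ℤ.- L) ℤ.* (+ 1 ℤ.+ (h ℤ.+ h))
      identity = solve-∀

    Ψ-mirror : ∀ {i} → i ℕ.< h → Ψ (i ℕ.+ toℕ k) ≈ Ψ (mirror i ℕ.+ toℕ k)
    Ψ-mirror {i} i<h = begin
      Ψ (i ℕ.+ toℕ k)                                 ≡⟨ ≡.cong (λ x → χ (Ψℤ x)) (ℤ.pos-+ i (toℕ k)) ⟩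
      χ (Ψℤ (+ i ℤ.+ + toℕ k))                        ≈⟨ χ-periodic-1+2h (Ψℤ ((+ h ℤ.+ + h) ℤ.- + i ℤ.+ + toℕ k))
                                                           (+ 2 ℤ.* (+ i ℤ.- + h) ℤ.* (B ℤ.+ A ℤ.* + toℕ k ℤ.+ A ℤ.+ A ℤ.* + h))
                                                           (identity (+ h) A B (+ toℕ k) (+ i)) ⟩
      χ (Ψℤ ((+ h ℤ.+ + h) ℤ.- + i ℤ.+ + toℕ k))      ≡⟨ ≡.cong (λ x → χ (Ψℤ x)) mirror-ℤ ⟨
      Ψ (mirror i ℕ.+ toℕ k)                          ∎
      where
      mirror-ℤ : + (mirror i ℕ.+ toℕ k) ≡ (+ h ℤ.+ + h) ℤ.- + i ℤ.+ + toℕ k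
      mirror-ℤ = ≡.trans (ℤ.pos-+ (mirror i) (toℕ k)) (≡.cong (ℤ._+ + toℕ k)
        (≡.trans (≡.cong (λ m → + (m ℕ.∸ i)) p∸1≡2h)
        (≡.trans (≡.sym (ℤ.⊖-≥ (ℕ.≤-trans (ℕ.<⇒≤ i<h) (ℕ.m≤m+n h h))))
        (≡.trans (≡.sym (ℤ.m-n≡m⊖n (h ℕ.+ h) i)) (≡.cong (ℤ._- + i) (ℤ.pos-+ h h))))))
      identity : ∀ h a b k i →
        ℤ.- ((a ℤ.* k ℤ.+ b) ℤ.* (i ℤ.+ k)) ℤ.+ (+ 1 ℤ.+ h) ℤ.* (i ℤ.+ k) ℤ.* (a ℤ.* (i ℤ.+ k) ℤ.+ + 2 ℤ.* b ℤ.+ a)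
          ≡ (ℤ.- ((a ℤ.* k ℤ.+ b) ℤ.* ((h ℤ.+ h) ℤ.- i ℤ.+ k))
               ℤ.+ (+ 1 ℤ.+ h) ℤ.* ((h ℤ.+ h) ℤ.- i ℤ.+ k) ℤ.* (a ℤ.* ((h ℤ.+ h) ℤ.- i ℤ.+ k) ℤ.+ + 2 ℤ.* b ℤ.+ a))
            ℤ.+ (+ 2 ℤ.* (i ℤ.- h) ℤ.* (b ℤ.+ a ℤ.* k ℤ.+ a ℤ.+ a ℤ.* h)) ℤ.* (+ 1 ℤ.+ (h ℤ.+ h))
      identity = solve-∀

  e-centre-≢ : ∀ k {y} → y ℕ.< p → h ≢ y → e [ toℕ k ℕ.+ h ] (pos k y) ≡ 0#
  e-centre-≢ k {y} y<p h≢y = ≡.trans (≡.cong (λ m → e m (pos k y)) (centre≡pos-h k)) (e-pos-≢ k h<p y<p h≢y)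

  generator⊥η : ∀ β (ix : GenIx β) → ⟨ gen ζ β ix , η ζ s β ⟩ ≈ 0#
  generator⊥η (βv k) (((_ , κ) , ≡.refl) , i) = trans (⟨MT-φ,⟩ ζ k κ i (η ζ s (βv k))) (x≈0∧y≈0⇒x-y≈0
    (trans (*-congˡ (reflexive (e-centre-≢ k (ℕ.<-trans i<h h<p) (ℕ.>⇒≢ i<h)))) (zeroʳ _))
    (trans (*-congˡ (reflexive (e-centre-≢ k (mirror<p (toℕ i)) (ℕ.<⇒≢ (h<mirror i<h))))) (zeroʳ _)))
    where i<h = Fin.toℕ<n i
  generator⊥η (βl a b) (((k , _) , ≡.refl) , i) = trans (⟨MT-φ,⟩ ζ k κ i (ηℓ a b)) (x≈y⇒x∙y⁻¹≈ε (begin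
    conj ((ζ ^ toℕ P) ^ toℕ κ) * ηℓ a b P       ≈⟨ conj-μ*ηℓ P ⟩
    s * Ψ (toℕ P)                               ≈⟨ *-congˡ Ψ-P≈Ψ-P′ ⟩
    s * Ψ (toℕ P′)                              ≈⟨ conj-μ*ηℓ P′ ⟨
    conj ((ζ ^ toℕ P′) ^ toℕ κ) * ηℓ a b P′     ∎))
    where
    open SlopeGenerator a b k
    i<h = Fin.toℕ<n i
    P  = pos k (toℕ i)
    P′ = pos k (mirror (toℕ i))
    Ψ-P≈Ψ-P′ : Ψ (toℕ P) ≈ Ψ (toℕ P′)
    Ψ-P≈Ψ-P′ = begin
      Ψ (toℕ P)                                   ≡⟨ ≡.cong Ψ (toℕ-[] _) ⟩
      Ψ ((toℕ i ℕ.+ toℕ k) % p)                   ≈⟨ periodic-% Ψ Ψ-periodic _ ⟩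
      Ψ (toℕ i ℕ.+ toℕ k)                         ≈⟨ Ψ-mirror i<h ⟩
      Ψ (mirror (toℕ i) ℕ.+ toℕ k)                ≈⟨ periodic-% Ψ Ψ-periodic _ ⟨
      Ψ ((mirror (toℕ i) ℕ.+ toℕ k) % p)          ≡⟨ ≡.cong Ψ (toℕ-[] _) ⟨
      Ψ (toℕ P′)                                  ∎

  span-η⊆⊥-generators : ∀ β v → InSpan1 (η ζ s β) v → InPerpSpan (gen ζ β) v
  span-η⊆⊥-generators β v (λ′ , v≈λ′η) = ⊥-generators⇒InPerpSpan (gen ζ β) v (λ ix → begin
    ⟨ gen ζ β ix , v ⟩                       ≈⟨ ⟨⟩-congʳ (gen ζ β ix) v≈λ′η ⟩
    ⟨ gen ζ β ix , (λ j → λ′ * η ζ s β j) ⟩  ≈⟨ ⟨⟩-*ʳ (gen ζ β ix) (η ζ s β) λ′ ⟩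
    λ′ * ⟨ gen ζ β ix , η ζ s β ⟩            ≈⟨ *-congˡ (generator⊥η β ix) ⟩
    λ′ * 0#                                  ≈⟨ zeroʳ λ′ ⟩
    0#                                       ∎)

  ⟨MT-φ,⟩≈0⇒ : ∀ k κ i {v} → ⟨ MT-φ ζ k κ i , v ⟩ ≈ 0# →
    conj ((ζ ^ toℕ (pos k (toℕ i))) ^ toℕ κ) * v (pos k (toℕ i))
      ≈ conj ((ζ ^ toℕ (pos k (mirror (toℕ i)))) ^ toℕ κ) * v (pos k (mirror (toℕ i)))
  ⟨MT-φ,⟩≈0⇒ k κ i {v} ⊥v = x∙y⁻¹≈ε⇒x≈y _ _ (trans (sym (⟨MT-φ,⟩ ζ k κ i v)) ⊥v)

  ζ^-≉ : ∀ {x y} → x ℕ.< p → y ℕ.< p → x ≢ y → ¬ ζ ^ x ≈ ζ ^ y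
  ζ^-≉ {x} {y} x<p y<p x≢y ζ^x≈ζ^y = χ≉1 (p∤-difference x<p y<p x≢y) (begin
    χ (+ x ℤ.+ ℤ.- + y)         ≈⟨ χ-+ (+ x) (ℤ.- + y) ⟩
    ζ ^ x * χ (ℤ.- + y)         ≈⟨ *-cong ζ^x≈ζ^y (χ-‿ (+ y)) ⟩
    ζ ^ y * conj (ζ ^ y)        ≈⟨ trans (*-comm _ _) (conj-χ*χ≈1 (+ y)) ⟩
    1#                          ∎)

  module VerticalComplement (k : Fin p) (v : Vec p) (v⊥ : InPerpSpan (gen ζ (βv k)) v) where
    m : Fin p
    m = [ toℕ k ℕ.+ h ]

    P P′ : Fin h → Fin p
    P  i = pos k (toℕ i)
    P′ i = pos k (mirror (toℕ i))

    relation : ∀ i n → n ℕ.< p → conj ((ζ ^ toℕ (P i)) ^ n) * v (P i) ≈ conj ((ζ ^ toℕ (P′ i)) ^ n) * v (P′ i)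
    relation i n n<p = ≡.subst (λ t → conj ((ζ ^ toℕ (P i)) ^ t) * v (P i) ≈ conj ((ζ ^ toℕ (P′ i)) ^ t) * v (P′ i))
      (Fin.toℕ-fromℕ< n<p)
      (⟨MT-φ,⟩≈0⇒ k κ i (InPerpSpan⇒⊥-generator (gen ζ (βv k)) v v⊥ (((k , κ) , ≡.refl) , i)))
      where κ = Fin.fromℕ< n<p

    v-P≈v-P′ : ∀ i → v (P i) ≈ v (P′ i)
    v-P≈v-P′ i = begin
      v (P i)              ≈⟨ trans (*-congʳ conj-1) (*-identityˡ _) ⟨
      conj 1# * v (P i)    ≈⟨ relation i 0 (ℕ.>-nonZero⁻¹ p) ⟩
      conj 1# * v (P′ i)   ≈⟨ trans (*-congʳ conj-1) (*-identityˡ _) ⟩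
      v (P′ i)             ∎

    v-P≈0 : ∀ i → v (P i) ≈ 0#
    v-P≈0 i = x*y≈0⇒y≈0 w≉w′ (begin
      (w - w′) * v (P i)                 ≈⟨ [y-z]x≈yx-zx _ w w′ ⟩
      w * v (P i) - w′ * v (P i)         ≈⟨ +-congˡ (-‿cong (*-congˡ (v-P≈v-P′ i))) ⟩
      w * v (P i) - w′ * v (P′ i)        ≈⟨ x≈y⇒x∙y⁻¹≈ε (relation i 1 1<p) ⟩
      0#                                 ∎)
      where
      x  = toℕ (P i)
      x′ = toℕ (P′ i)
      i<h = Fin.toℕ<n i
      w w′ : Carrier
      w  = conj (ζ ^ x * 1#)
      w′ = conj (ζ ^ x′ * 1#)
      x≢x′ : x ≢ x′
      x≢x′ eq = ℕ.<⇒≢ (ℕ.<-trans i<h (h<mirror i<h))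
        (pos-injective k (ℕ.<-trans i<h h<p) (mirror<p (toℕ i)) (Fin.toℕ-injective eq))
      w≉w′ : ¬ w - w′ ≈ 0#
      w≉w′ w-w′≈0 = ζ^-≉ (Fin.toℕ<n _) (Fin.toℕ<n _) x≢x′ (begin
        ζ ^ x                  ≈⟨ *-identityʳ _ ⟨
        ζ ^ x * 1#             ≈⟨ conj-inv _ ⟨
        conj w                 ≈⟨ conj-cong (x∙y⁻¹≈ε⇒x≈y w w′ w-w′≈0) ⟩
        conj w′                ≈⟨ conj-inv _ ⟩
        ζ ^ x′ * 1#            ≈⟨ *-identityʳ _ ⟩
        ζ ^ x′                 ∎)

    vanishes-off-centre : ∀ j → j ≢ pos k h → v j ≈ 0#
    vanishes-off-centre j j≢c with pos-cover k j j≢c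
    ... | i , inj₁ ≡.refl = v-P≈0 i
    ... | i , inj₂ ≡.refl = trans (sym (v-P≈v-P′ i)) (v-P≈0 i)

    ∈span-η : InSpan1 (η ζ s (βv k)) v
    ∈span-η = v m , pointwise
      where
      pointwise : ∀ j → v j ≈ v m * e m j
      pointwise j with m Fin.≟ j
      ... | yes ≡.refl = trans (sym (*-identityʳ _)) (*-congˡ (sym (reflexive (e-≡ m m ≡.refl))))
      ... | no m≢j = trans (vanishes-off-centre j (λ j≡c → m≢j (≡.trans (centre≡pos-h k) (≡.sym j≡c))))
                           (sym (trans (*-congˡ (reflexive (e-≢ m j (λ eq → m≢j (Fin.toℕ-injective eq))))) (zeroʳ _)))

  module SlopeComplement (a b : Fin p) (v : Vec p) (v⊥ : InPerpSpan (gen ζ (βl a b)) v) where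
    w : ℕ → Carrier
    w n = v [ n ]

    -- the generator with k = n + 1 and i = 0 links the entries at n + 1 and n
    step : ∀ n (n+1<p : suc n ℕ.< p) → let open SlopeGenerator a b (Fin.fromℕ< n+1<p) in
      w (suc n) ≈ (χ (L ℤ.* + suc n) * conj (χ (L ℤ.* + n))) * w n
    step n n+1<p = begin
      w (suc n)                              ≈⟨ *-identityˡ _ ⟨
      1# * w (suc n)                         ≈⟨ *-congʳ (trans (*-comm _ _) (conj-χ*χ≈1 y₁)) ⟨
      (χ y₁ * conj (χ y₁)) * w (suc n)       ≈⟨ *-assoc _ _ _ ⟩
      χ y₁ * (conj (χ y₁) * w (suc n))       ≈⟨ *-congˡ relation ⟩
      χ y₁ * (conj (χ y₀) * w n)             ≈⟨ *-assoc _ _ _ ⟨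
      (χ y₁ * conj (χ y₀)) * w n             ∎
      where
      k = Fin.fromℕ< n+1<p
      open SlopeGenerator a b k
      i₀ = Fin.fromℕ< 0<h
      y₁ = L ℤ.* + suc n
      y₀ = L ℤ.* + n
      at : ∀ {P x} → P ≡ [ x ] → x ℕ.< p → conj ((ζ ^ toℕ P) ^ toℕ κ) * v P ≈ conj (χ (L ℤ.* + x)) * w x
      at {x = x} ≡.refl x<p =
        *-congʳ (conj-cong (trans (reflexive (≡.cong (λ t → (ζ ^ t) ^ toℕ κ) (toℕ-[]-< x<p))) (μ≈χ x)))
      P≡ : pos k (toℕ i₀) ≡ [ suc n ]
      P≡ = ≡.cong₂ (λ x y → [ x ℕ.+ y ]) (Fin.toℕ-fromℕ< 0<h) (Fin.toℕ-fromℕ< n+1<p)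
      P′≡ : pos k (mirror (toℕ i₀)) ≡ [ n ]
      P′≡ = ≡.trans (≡.cong₂ (λ x y → [ mirror x ℕ.+ y ]) (Fin.toℕ-fromℕ< 0<h) (Fin.toℕ-fromℕ< n+1<p))
        (≡.trans (≡.cong [_] (≡.trans (ℕ.+-suc (p ℕ.∸ 1) n) (≡.trans (≡.cong (ℕ._+ n) (ℕ.suc-pred p)) (ℕ.+-comm p n))))
                 ([]-+p n))
      relation : conj (χ y₁) * w (suc n) ≈ conj (χ y₀) * w n
      relation = trans (sym (at P≡ n+1<p))
        (trans (⟨MT-φ,⟩≈0⇒ k κ i₀ (InPerpSpan⇒⊥-generator (gen ζ (βl a b)) v v⊥ (((k , κ) , ≡.refl) , i₀)))
               (at P′≡ (ℕ.<-trans (ℕ.n<1+n n) n+1<p)))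

    w≈χ-phase*w0 : ∀ n → n ℕ.< p → w n ≈ χ (phase a b (+ n)) * w 0
    w≈χ-phase*w0 zero    _     = trans (sym (*-identityˡ _)) (*-congʳ (reflexive (≡.cong χ (≡.sym (phase-0 (+ h) (+ toℕ a) (+ toℕ b))))))
      where
      phase-0 : ∀ h a b → (+ 1 ℤ.+ h) ℤ.* + 0 ℤ.* (a ℤ.* + 0 ℤ.+ + 2 ℤ.* b ℤ.+ a) ≡ + 0
      phase-0 = solve-∀
    w≈χ-phase*w0 (suc n) n+1<p = begin
      w (suc n)                                           ≈⟨ step n n+1<p ⟩
      (χ y₁ * conj (χ y₀)) * w n                          ≈⟨ *-congˡ (w≈χ-phase*w0 n (ℕ.<-trans (ℕ.n<1+n n) n+1<p)) ⟩
      (χ y₁ * conj (χ y₀)) * (χ (phase a b (+ n)) * w 0)  ≈⟨ *-congʳ (*-congˡ (χ-‿ y₀)) ⟨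
      (χ y₁ * χ (ℤ.- y₀)) * (χ (phase a b (+ n)) * w 0)   ≈⟨ *-assoc _ _ _ ⟨
      ((χ y₁ * χ (ℤ.- y₀)) * χ (phase a b (+ n))) * w 0
        ≈⟨ *-congʳ (trans (χ-+ (y₁ ℤ.+ ℤ.- y₀) (phase a b (+ n))) (*-congʳ (χ-+ y₁ (ℤ.- y₀)))) ⟨
      χ (y₁ ℤ.+ ℤ.- y₀ ℤ.+ phase a b (+ n)) * w 0         ≈⟨ *-congʳ (χ-periodic-1+2h (phase a b (+ suc n)) (ℤ.- L) recursion) ⟩
      χ (phase a b (+ suc n)) * w 0                       ∎
      where
      open SlopeGenerator a b (Fin.fromℕ< n+1<p)
      y₁ = L ℤ.* + suc n
      y₀ = L ℤ.* + n
      +suc≡ : + suc n ≡ + n ℤ.+ + 1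
      +suc≡ = ≡.trans (≡.cong +_ (ℕ.+-comm 1 n)) (ℤ.pos-+ n 1)
      L≡ : L ≡ A ℤ.* (+ n ℤ.+ + 1) ℤ.+ B
      L≡ = ≡.cong (λ t → A ℤ.* t ℤ.+ B) (≡.trans (≡.cong +_ (Fin.toℕ-fromℕ< n+1<p)) +suc≡)
      identity : ∀ h a b n →
        (a ℤ.* (n ℤ.+ + 1) ℤ.+ b) ℤ.* (n ℤ.+ + 1) ℤ.+ ℤ.- ((a ℤ.* (n ℤ.+ + 1) ℤ.+ b) ℤ.* n)
          ℤ.+ (+ 1 ℤ.+ h) ℤ.* n ℤ.* (a ℤ.* n ℤ.+ + 2 ℤ.* b ℤ.+ a)
        ≡ (+ 1 ℤ.+ h) ℤ.* (n ℤ.+ + 1) ℤ.* (a ℤ.* (n ℤ.+ + 1) ℤ.+ + 2 ℤ.* b ℤ.+ a)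
          ℤ.+ ℤ.- (a ℤ.* (n ℤ.+ + 1) ℤ.+ b) ℤ.* (+ 1 ℤ.+ (h ℤ.+ h))
      identity = solve-∀
      recursion : y₁ ℤ.+ ℤ.- y₀ ℤ.+ phase a b (+ n) ≡ phase a b (+ suc n) ℤ.+ ℤ.- L ℤ.* (+ 1 ℤ.+ (+ h ℤ.+ + h))
      recursion = ≡.subst₂
        (λ L′ m → L′ ℤ.* m ℤ.+ ℤ.- (L′ ℤ.* + n) ℤ.+ phase a b (+ n) ≡ phase a b m ℤ.+ ℤ.- L′ ℤ.* (+ 1 ℤ.+ (+ h ℤ.+ + h)))
        (≡.sym L≡) (≡.sym +suc≡) (identity (+ h) A B (+ n))

    ∈span-η : InSpan1 (ηℓ a b) v
    ∈span-η = (fromℕ p * s) * w 0 , proportional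
      where
      proportional : ∀ j → v j ≈ ((fromℕ p * s) * w 0) * ηℓ a b j
      proportional j = begin
        v j                                            ≡⟨ ≡.cong v ([]-toℕ j) ⟨
        w (toℕ j)                                      ≈⟨ w≈χ-phase*w0 (toℕ j) (Fin.toℕ<n j) ⟩
        χ φj * w 0                                     ≈⟨ *-identityˡ _ ⟨
        1# * (χ φj * w 0)                              ≈⟨ *-congʳ ps²≈1 ⟨
        (fromℕ p * (s * s)) * (χ φj * w 0)             ≈⟨ solve 4 (λ P s x w → (P :* (s :* s)) :* (x :* w) := ((P :* s) :* w) :* (s :* x))
                                                            refl (fromℕ p) s (χ φj) (w 0) ⟩
        ((fromℕ p * s) * w 0) * (s * χ φj)             ≈⟨ *-congˡ (ηℓ-χ a b j) ⟨
        ((fromℕ p * s) * w 0) * ηℓ a b j               ∎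
        where φj = phase a b (+ toℕ j)

  ⊥-generators⊆span-η : ∀ β v → InPerpSpan (gen ζ β) v → InSpan1 (η ζ s β) v
  ⊥-generators⊆span-η (βv k)   v v⊥ = VerticalComplement.∈span-η k v v⊥
  ⊥-generators⊆span-η (βl a b) v v⊥ = SlopeComplement.∈span-η a b v v⊥

  η-orthogonal : ∀ β β′ → classOf β ≡ classOf β′ → β ≢ β′ → ⟨ η ζ s β , η ζ s β′ ⟩ ≈ 0#
  η-orthogonal (βv k)   (βv k′)    _      β≢β′ = ηv⊥ηv (λ k≡k′ → β≢β′ (≡.cong βv k≡k′))
  η-orthogonal (βl a b) (βl .a b′) ≡.refl β≢β′ = ηℓ⊥ηℓ {a} (λ b≡b′ → β≢β′ (≡.cong (βl a) b≡b′))

  η-unbiased : ∀ β β′ → classOf β ≢ classOf β′ →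
    ⟨ η ζ s β , η ζ s β′ ⟩ * conj ⟨ η ζ s β , η ζ s β′ ⟩ ≈ s * s
  η-unbiased (βv k)   (βv k′)    C≢C′ = ⊥-elim (C≢C′ ≡.refl)
  η-unbiased (βv k)   (βl a b)   _    = ηv-ηℓ-unbiased k a b
  η-unbiased (βl a b) (βv k)     _    = unbiased-swap _ _ (ηv-ηℓ-unbiased k a b)
  η-unbiased (βl a b) (βl a′ b′) C≢C′ = ηℓ-ηℓ-unbiased b b′ (λ a≡a′ → C≢C′ (≡.cong slope a≡a′))

theorem7p2 : ∀ {c ℓ : Level} (F : StarField c ℓ) (p : ℕ) {{_ : NonZero p}} →
    Prime p → p % 2 ≡ 1 →
    let open StarField F
        open Construction F
        open ZMod p
    in (ζ s : Carrier) →
    ζ ^ p ≈ 1# → ¬ (ζ ≈ 1#) → conj ζ * ζ ≈ 1# →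
    conj s ≈ s → fromℕ p * (s * s) ≈ 1# →
    -- each parallel class is an orthonormal basis of F^p
    ((β : Block) → ⟨ η ζ s β , η ζ s β ⟩ ≈ 1#)
    × ((β β' : Block) → classOf β ≡ classOf β' → β ≢ β' → ⟨ η ζ s β , η ζ s β' ⟩ ≈ 0#)
    × ((C : Class) (v : Vec p) →
         InSpan (λ (βc : Σ Block (λ β → classOf β ≡ C)) → η ζ s (proj₁ βc)) v)
    -- vectors from different classes are unbiased: |⟨η,η'⟩|² = 1/p
    × ((β β' : Block) → classOf β ≢ classOf β' →
         ⟨ η ζ s β , η ζ s β' ⟩ * conj ⟨ η ζ s β , η ζ s β' ⟩ ≈ s * s)
    -- span η^{(β)} = (span {M^κ T^k φ_i : (k,κ) ∈ β, i})^⊥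
    × ((β : Block) (v : Vec p) →
         (InSpan1 (η ζ s β) v → InPerpSpan (gen ζ β) v)
         × (InPerpSpan (gen ζ β) v → InSpan1 (η ζ s β) v))
theorem7p2 F p p-prime p-odd ζ s ζ^p≈1 ζ≉1 ζ̄ζ≈1 s̄≈s ps²≈1 =
  ‖η‖≈1 , η-orthogonal , η-spans , η-unbiased ,
  λ β v → span-η⊆⊥-generators β v , ⊥-generators⊆span-η β v
  where open MutuallyUnbiasedBases F p p-prime p-odd ζ s ζ^p≈1 ζ≉1 ζ̄ζ≈1 s̄≈s ps²≈1
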